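{- (1) In every modal $\omega$-algebra, every Noetherian element $a$ is $\omega$-Noetherian, i.e. $a^\omega\le 0$. (2) There is a modal $\omega$-algebra containing an $\omega$-Noetherian element that is Noetherian, and one containing an $\omega$-Noetherian element that is not Noetherian. (3) There is an extensional modal $\omega$-algebra containing an $\omega$-Noetherian element that is not Noetherian.
   Context: An idempotent semiring is a structure $(S,+,\cdot,0,1)$ such that $(S,+,0)$ is a commutative monoid with $a+a=a$, $(S,\cdot,1)$ is a monoid, multiplication distributes over addition from both sides, and $0a=a0=0$; natural order $a\le b\iff a+b=b$. A test is an element $p\le 1$ for which some $q$ satisfies $p+q=1$ and $pq=0=qp$; $q$ is unique, written $\neg p$; tests form a Boolean algebra $\mathrm{test}(S)$; $p-q=p\cdot\neg q$. $S$ is a modal semiring if for each $a\in S$ there are maps $|a\rangle,\langle a|$ on $\mathrm{test}(S)$ with, for all $a,b,p,q$: $|a\rangle p\le q\iff \neg q\,a\,p\le 0$; $\langle a|p\le q\iff p\,a\,\neg q\le 0$; $|ab\rangle p=|a\rangle(|b\rangle p)$; $\langle ab|p=\langle b|(\langle a|p)$. A Kleene algebra is an idempotent semiring with ${}^*$ such that $1+aa^*\le a^*$, $b+ac\le c\Rightarrow a^*b\le c$, $1+a^*a\le a^*$, $b+ca\le c\Rightarrow ba^*\le c$. An $\omega$-algebra is a Kleene algebra with ${}^\omega$ such that $a^\omega\le aa^\omega$ and $c\le ac+b\Rightarrow c\le a^\omega+a^*b$. A modal $\omega$-algebra is an $\omega$-algebra that is a modal semiring; it is extensional if $|a\rangle\le|b\rangle$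 implies $a\le b$. An element $a$ is Noetherian if for all tests $p$, $p-|a\rangle p\le 0$ implies $p\le 0$; it is $\omega$-Noetherian if $a^\omega\le 0$. -}

module Defs where

open import Level using (Level; suc; _⊔_)
open import Data.Product using (Σ; Σ-syntax; ∃; _×_; _,_; proj₁; proj₂)
open import Relation.Binary.PropositionalEquality using (_≡_)

record ModalOmegaAlgebra (ℓ : Level) : Set (suc ℓ) where
  infixl 6 _+_
  infixl 7 _·_
  infix 4 _≤_
  field
    Carrier : Set ℓ
    _+_ _·_ : Carrier → Carrier → Carrier
    𝟘 𝟙 : Carrier
    _⋆ _ω : Carrier → Carrier
    +-assoc : ∀ a b c → (a + b) + c ≡ a + (b + c)
    +-comm  : ∀ a b → a + b ≡ b + a
    +-identityˡ : ∀ a → 𝟘 + a ≡ a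
    +-idem  : ∀ a → a + a ≡ a
    ·-assoc : ∀ a b c → (a · b) · c ≡ a · (b · c)
    ·-identityˡ : ∀ a → 𝟙 · a ≡ a
    ·-identityʳ : ∀ a → a · 𝟙 ≡ a
    distribˡ : ∀ a b c → a · (b + c) ≡ a · b + a · c
    distribʳ : ∀ a b c → (b + c) · a ≡ b · a + c · a
    zeroˡ : ∀ a → 𝟘 · a ≡ 𝟘
    zeroʳ : ∀ a → a · 𝟘 ≡ 𝟘

  _≤_ : Carrier → Carrier → Set ℓ
  a ≤ b = a + b ≡ b

  IsComplement : Carrier → Carrier → Set ℓ
  IsComplement p q = (p + q ≡ 𝟙) × (p · q ≡ 𝟘) × (q · p ≡ 𝟘)

  IsTest : Carrier → Set ℓ
  IsTest p = (p ≤ 𝟙) × (Σ[ q ∈ Carrier ] IsComplement p q)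

  Test : Set ℓ
  Test = Σ[ p ∈ Carrier ] IsTest p

  ⌊_⌋ : Test → Carrier
  ⌊ t ⌋ = proj₁ t

  -- complement of a test (unique, as the witness is determined)
  ¬ₜ : Test → Carrier
  ¬ₜ t = proj₁ (proj₂ (proj₂ t))

  field
    star-unfoldˡ : ∀ a → 𝟙 + a · (a ⋆) ≤ a ⋆
    star-inductˡ : ∀ a b c → b + a · c ≤ c → (a ⋆) · b ≤ c
    star-unfoldʳ : ∀ a → 𝟙 + (a ⋆) · a ≤ a ⋆
    star-inductʳ : ∀ a b c → b + c · a ≤ c → b · (a ⋆) ≤ c
    omega-unfold : ∀ a → a ω ≤ a · (a ω)
    omega-coinduct : ∀ a b c → c ≤ a · c + b → c ≤ a ω + (a ⋆) · b
    fdia : Carrier → Test → Test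
    bdia : Carrier → Test → Test
    fdia-galois : ∀ a (p q : Test) → (⌊ fdia a p ⌋ ≤ ⌊ q ⌋ → ¬ₜ q · a · ⌊ p ⌋ ≤ 𝟘)
                                   × (¬ₜ q · a · ⌊ p ⌋ ≤ 𝟘 → ⌊ fdia a p ⌋ ≤ ⌊ q ⌋)
    bdia-galois : ∀ a (p q : Test) → (⌊ bdia a p ⌋ ≤ ⌊ q ⌋ → ⌊ p ⌋ · a · ¬ₜ q ≤ 𝟘)
                                   × (⌊ p ⌋ · a · ¬ₜ q ≤ 𝟘 → ⌊ bdia a p ⌋ ≤ ⌊ q ⌋)
    fdia-comp : ∀ a b (p : Test) → ⌊ fdia (a · b) p ⌋ ≡ ⌊ fdia a (fdia b p) ⌋
    bdia-comp : ∀ a b (p : Test) → ⌊ bdia (a · b) p ⌋ ≡ ⌊ bdia b (bdia a p) ⌋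

  _∸ₜ_ : Test → Test → Carrier
  p ∸ₜ q = ⌊ p ⌋ · ¬ₜ q

  Noetherian : Carrier → Set ℓ
  Noetherian a = ∀ (p : Test) → p ∸ₜ fdia a p ≤ 𝟘 → ⌊ p ⌋ ≤ 𝟘

  ωNoetherian : Carrier → Set ℓ
  ωNoetherian a = a ω ≤ 𝟘

  Extensional : Set ℓ
  Extensional = ∀ a b → (∀ (p : Test) → ⌊ fdia a p ⌋ ≤ ⌊ fdia b p ⌋) → a ≤ b

module Submission where

-- (1) is proved abstractly in ModalFacts: for p = |aω⟩1 the unfold law
--     aω ≤ a·aω gives p ≤ |a⟩p, so a Noetherian a forces p ≤ 0, and the
--     Galois connection turns this into aω ≤ 0.  The same module shows that 0
--     is always Noetherian and that a total element (one that no nonzero test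
--     annihilates from the left) of a nontrivial algebra is never Noetherian.
-- (2) and (3) use a single concrete extensional model: relations on ℕ that
--     only contain forward pairs (x , x + k) and are regular (all rows from some
--     N on are equal, every row is eventually constant, and the common far row
--     has the form {0 | δ} ∪ [m+1, ∞)).  Such relations have unique finite
--     descriptions, so equality of relations is propositional equality.  In the
--     model r* is the union of the first N + 2 powers of r, and rω is "reach an
--     r-loop by r*, then move anywhere forward": a forward path towards a fixed
--     target can take only finitely many positive steps.  Singleton tests make
--     the model extensional.  The relation x < y has no loops, so it is
--     ω-Noetherian, but it is total, so it is not Noetherian; 0 is both.

open import Defs
open import Level using (Level; 0ℓ)
open import Data.Product using (Σ; Σ-syntax; _×_; _,_; proj₁; proj₂)
open import Relation.Nullary using (¬_)
open import Relation.Binary.Definitions using (DecidableEquality)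
open import Relation.Binary.PropositionalEquality using (_≡_; sym; trans; cong; subst; module ≡-Reasoning)

module ModalFacts {ℓ : Level} (M : ModalOmegaAlgebra ℓ) where
  open ModalOmegaAlgebra M
  open ≡-Reasoning

  +-identityʳ : ∀ a → a + 𝟘 ≡ a
  +-identityʳ a = trans (+-comm a 𝟘) (+-identityˡ a)

  ≤-trans : ∀ {a b c} → a ≤ b → b ≤ c → a ≤ c
  ≤-trans {a} {b} {c} a≤b b≤c = begin
    a + c        ≡⟨ cong (a +_) (sym b≤c) ⟩
    a + (b + c)  ≡⟨ sym (+-assoc a b c) ⟩
    (a + b) + c  ≡⟨ cong (_+ c) a≤b ⟩
    b + c        ≡⟨ b≤c ⟩
    c            ∎

  ·-monoˡ : ∀ {a b} c → a ≤ b → a · c ≤ b · c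
  ·-monoˡ {a} {b} c a≤b = trans (sym (distribʳ c a b)) (cong (_· c) a≤b)

  ·-monoʳ : ∀ {a b} c → a ≤ b → c · a ≤ c · b
  ·-monoʳ {a} {b} c a≤b = trans (sym (distribˡ c a b)) (cong (c ·_) a≤b)

  oneT : Test
  oneT = 𝟙 , +-idem 𝟙 , 𝟘 , +-identityʳ 𝟙 , zeroʳ 𝟙 , zeroˡ 𝟙

  zeroT : Test
  zeroT = 𝟘 , +-identityˡ 𝟙 , 𝟙 , +-identityˡ 𝟙 , zeroˡ 𝟙 , zeroʳ 𝟙

  complementT : Test → Test
  complementT (p , _ , q , p+q≡1 , pq≡0 , qp≡0) = q , q≤1 , p , trans (+-comm q p) p+q≡1 , qp≡0 , pq≡0
    where
      q≤1 : q ≤ 𝟙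
      q≤1 = begin
        q + 𝟙        ≡⟨ cong (q +_) (sym (trans (+-comm q p) p+q≡1)) ⟩
        q + (q + p)  ≡⟨ sym (+-assoc q q p) ⟩
        (q + q) + p  ≡⟨ cong (_+ p) (+-idem q) ⟩
        q + p        ≡⟨ trans (+-comm q p) p+q≡1 ⟩
        𝟙            ∎

  fdia-mono : ∀ {a b} (p : Test) → a ≤ b → ⌊ fdia a p ⌋ ≤ ⌊ fdia b p ⌋
  fdia-mono {a} {b} p a≤b = proj₂ (fdia-galois a p (fdia b p))
    (≤-trans (·-monoˡ ⌊ p ⌋ (·-monoʳ (¬ₜ (fdia b p)) a≤b))
             (proj₁ (fdia-galois b p (fdia b p)) (+-idem _)))

  -- Part (1): with p = |aω⟩1, unfolding aω ≤ a·aω gives p ≤ |a⟩p, so p - |a⟩p ≤ 0;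
  -- Noetherianity forces p ≤ 0, and by the Galois connection aω = 1·aω·1 ≤ 0.
  noetherian⇒ωNoetherian : ∀ a → Noetherian a → ωNoetherian a
  noetherian⇒ωNoetherian a noetherian =
    subst (_≤ 𝟘) (trans (·-identityʳ _) (·-identityˡ _)) (proj₁ (fdia-galois (a ω) oneT zeroT) p≤0)
    where
      p : Test
      p = fdia (a ω) oneT
      p≤|a⟩p : ⌊ p ⌋ ≤ ⌊ fdia a p ⌋
      p≤|a⟩p = subst (⌊ p ⌋ ≤_) (fdia-comp a (a ω) oneT) (fdia-mono oneT (omega-unfold a))
      p∸|a⟩p≤0 : p ∸ₜ fdia a p ≤ 𝟘
      p∸|a⟩p≤0 = subst (p ∸ₜ fdia a p ≤_) (proj₁ (proj₂ (proj₂ (proj₂ (proj₂ (fdia a p))))))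
                   (·-monoˡ (¬ₜ (fdia a p)) p≤|a⟩p)
      p≤0 : ⌊ p ⌋ ≤ 𝟘
      p≤0 = noetherian p p∸|a⟩p≤0

  ≤𝟘⇒≡𝟘 : ∀ {a} → a ≤ 𝟘 → a ≡ 𝟘
  ≤𝟘⇒≡𝟘 {a} a≤0 = trans (sym (+-identityʳ a)) a≤0

  -- 0 is Noetherian: |0⟩p = 0 by the Galois connection, its complement is 1,
  -- so p - |0⟩p = p.
  𝟘-noetherian : Noetherian 𝟘
  𝟘-noetherian p p∸q≤0 = subst (_≤ 𝟘) p∸q≡p p∸q≤0
    where
      q : Test
      q = fdia 𝟘 p
      annihilated : ¬ₜ zeroT · 𝟘 · ⌊ p ⌋ ≤ 𝟘
      annihilated = subst (_≤ 𝟘) (sym (trans (cong (_· ⌊ p ⌋) (zeroʳ 𝟙)) (zeroˡ ⌊ p ⌋))) (+-idem 𝟘)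
      q≡0 : ⌊ q ⌋ ≡ 𝟘
      q≡0 = ≤𝟘⇒≡𝟘 (proj₂ (fdia-galois 𝟘 p zeroT) annihilated)
      ¬q≡1 : ¬ₜ q ≡ 𝟙
      ¬q≡1 = begin
        ¬ₜ q          ≡⟨ sym (+-identityˡ (¬ₜ q)) ⟩
        𝟘 + ¬ₜ q      ≡⟨ cong (_+ ¬ₜ q) (sym q≡0) ⟩
        ⌊ q ⌋ + ¬ₜ q  ≡⟨ proj₁ (proj₂ (proj₂ (proj₂ q))) ⟩
        𝟙             ∎
      p∸q≡p : p ∸ₜ q ≡ ⌊ p ⌋
      p∸q≡p = trans (cong (⌊ p ⌋ ·_) ¬q≡1) (·-identityʳ ⌊ p ⌋)

  -- An element is total when no nonzero test annihilates it from the left,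
  -- i.e. every state has an a-successor.
  Total : Carrier → Set ℓ
  Total a = ∀ (r : Test) → ⌊ r ⌋ · a ≤ 𝟘 → ⌊ r ⌋ ≤ 𝟘

  -- In a nontrivial algebra a total element is not Noetherian: for p = 1 the
  -- complement of |a⟩1 annihilates a, hence 1 - |a⟩1 ≤ 0 although 1 ≰ 0.
  total⇒¬noetherian : ¬ (𝟙 ≤ 𝟘) → ∀ a → Total a → ¬ Noetherian a
  total⇒¬noetherian 1≰0 a total noetherian = 1≰0 (noetherian oneT 1∸|a⟩1≤0)
    where
      q : Test
      q = fdia a oneT
      ¬q·a≤0 : ¬ₜ q · a ≤ 𝟘
      ¬q·a≤0 = subst (_≤ 𝟘) (·-identityʳ _) (proj₁ (fdia-galois a oneT q) (+-idem ⌊ q ⌋))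
      1∸|a⟩1≤0 : oneT ∸ₜ q ≤ 𝟘
      1∸|a⟩1≤0 = subst (_≤ 𝟘) (sym (·-identityˡ (¬ₜ q))) (total (complementT q) ¬q·a≤0)

module Booleans where

  open import Data.Nat using (ℕ; zero; suc; _≤_; z≤n; s≤s; _≤ᵇ_; _≡ᵇ_)
  open import Data.Nat.Properties using (≤ᵇ⇒≤; ≤⇒≤ᵇ; ≡ᵇ⇒≡; ≡⇒≡ᵇ)
  open import Data.Bool using (Bool; true; false; _∧_; _∨_; not)
  open import Data.Bool.Properties using (T-≡)
  open import Data.Product using (Σ; _×_; _,_)
  open import Data.Sum using (_⊎_; inj₁; inj₂)
  open import Data.Empty using (⊥-elim)
  open import Function.Bundles using (Equivalence)
  open import Relation.Nullary using (¬_)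
  open import Relation.Binary.PropositionalEquality using (_≡_; refl; sym; cong₂)

  true-ext : ∀ {b c : Bool} → (b ≡ true → c ≡ true) → (c ≡ true → b ≡ true) → b ≡ c
  true-ext {true}  {true}  _ _ = refl
  true-ext {true}  {false} f _ = sym (f refl)
  true-ext {false} {true}  _ g = g refl
  true-ext {false} {false} _ _ = refl

  false≢true : ¬ (false ≡ true)
  false≢true ()

  ∧-intro : ∀ {a b} → a ≡ true → b ≡ true → (a ∧ b) ≡ true
  ∧-intro refl refl = refl

  ∧-elimˡ : ∀ a {b} → (a ∧ b) ≡ true → a ≡ true
  ∧-elimˡ true _ = refl

  ∧-elimʳ : ∀ a {b} → (a ∧ b) ≡ true → b ≡ true
  ∧-elimʳ true e = e

  ∨-elim : ∀ a {b} → (a ∨ b) ≡ true → (a ≡ true) ⊎ (b ≡ true)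
  ∨-elim true  _ = inj₁ refl
  ∨-elim false e = inj₂ e

  ∨-introˡ : ∀ {a} b → a ≡ true → (a ∨ b) ≡ true
  ∨-introˡ _ refl = refl

  ∨-introʳ : ∀ a {b} → b ≡ true → (a ∨ b) ≡ true
  ∨-introʳ true  _ = refl
  ∨-introʳ false e = e

  not-true : ∀ {a} → a ≡ true → not a ≡ false
  not-true refl = refl

  ≤ᵇ-complete : ∀ {m n} → m ≤ n → (m ≤ᵇ n) ≡ true
  ≤ᵇ-complete m≤n = Equivalence.to T-≡ (≤⇒≤ᵇ m≤n)

  ≤ᵇ-sound : ∀ m n → (m ≤ᵇ n) ≡ true → m ≤ n
  ≤ᵇ-sound m n e = ≤ᵇ⇒≤ m n (Equivalence.from T-≡ e)

  ≡ᵇ-sound : ∀ m n → (m ≡ᵇ n) ≡ true → m ≡ n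
  ≡ᵇ-sound m n e = ≡ᵇ⇒≡ m n (Equivalence.from T-≡ e)

  ≡ᵇ-refl : ∀ n → (n ≡ᵇ n) ≡ true
  ≡ᵇ-refl n = Equivalence.to T-≡ (≡⇒≡ᵇ n n refl)

  anyUpTo : ℕ → (ℕ → Bool) → Bool
  anyUpTo zero    f = f 0
  anyUpTo (suc k) f = f 0 ∨ anyUpTo k (λ i → f (suc i))

  anyUpTo-intro : ∀ k f i → i ≤ k → f i ≡ true → anyUpTo k f ≡ true
  anyUpTo-intro zero    f zero    _         e = e
  anyUpTo-intro (suc k) f zero    _         e = ∨-introˡ (anyUpTo k (λ i → f (suc i))) e
  anyUpTo-intro (suc k) f (suc i) (s≤s i≤k) e = ∨-introʳ (f 0) (anyUpTo-intro k (λ i → f (suc i)) i i≤k e)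

  anyUpTo-elim : ∀ k f → anyUpTo k f ≡ true → Σ ℕ (λ i → (i ≤ k) × (f i ≡ true))
  anyUpTo-elim zero    f e = 0 , z≤n , e
  anyUpTo-elim (suc k) f e with ∨-elim (f 0) e
  ... | inj₁ f0 = 0 , z≤n , f0
  ... | inj₂ rest with anyUpTo-elim k (λ i → f (suc i)) rest
  ...   | i , i≤k , fi = suc i , s≤s i≤k , fi

  anyUpTo-cong : ∀ k (f g : ℕ → Bool) → (∀ i → f i ≡ g i) → anyUpTo k f ≡ anyUpTo k g
  anyUpTo-cong zero    f g f≗g = f≗g 0
  anyUpTo-cong (suc k) f g f≗g =
    cong₂ _∨_ (f≗g 0) (anyUpTo-cong k (λ i → f (suc i)) (λ i → g (suc i)) (λ i → f≗g (suc i)))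

  ≡ᵇ-false : ∀ m n → ¬ (m ≡ n) → (m ≡ᵇ n) ≡ false
  ≡ᵇ-false m n m≢n with m ≡ᵇ n in e
  ... | true  = ⊥-elim (m≢n (≡ᵇ-sound m n e))
  ... | false = refl

-- A list xs together with a default d describes the eventually constant
-- sequence  at xs d : ℕ → A  (the entries of xs, then d forever).  The list is
-- trimmed when it does not end in d; trimmed lists represent sequences uniquely.
module Trimming {A : Set} (_≟_ : DecidableEquality A) where

  open import Data.Nat using (ℕ; zero; suc; _≤_; s≤s)
  open import Data.List using (List; []; _∷_; length)
  open import Data.List.Properties using (∷-injectiveʳ)
  open import Data.Empty using (⊥-elim)
  open import Relation.Nullary using (yes; no)
  open import Relation.Binary.PropositionalEquality using (_≡_; refl; sym; trans; cong; cong₂)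

  at : List A → A → ℕ → A
  at []       d _       = d
  at (x ∷ xs) d zero    = x
  at (x ∷ xs) d (suc k) = at xs d k

  at-beyond : ∀ xs d k → length xs ≤ k → at xs d k ≡ d
  at-beyond []       d k       _         = refl
  at-beyond (x ∷ xs) d (suc k) (s≤s le) = at-beyond xs d k le

  consTrim : A → List A → A → List A
  consTrim x []       d with x ≟ d
  ... | yes _ = []
  ... | no  _ = x ∷ []
  consTrim x (y ∷ ys) d = x ∷ y ∷ ys

  trim : List A → A → List A
  trim []       d = []
  trim (x ∷ xs) d = consTrim x (trim xs d) d

  Trimmed : List A → A → Set
  Trimmed xs d = trim xs d ≡ xs

  at-consTrim : ∀ x ys d k → at (consTrim x ys d) d k ≡ at (x ∷ ys) d k
  at-consTrim x []       d k with x ≟ d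
  at-consTrim x []       d zero    | yes x≡d = sym x≡d
  at-consTrim x []       d (suc k) | yes _   = refl
  ... | no _ = refl
  at-consTrim x (y ∷ ys) d k = refl

  at-trim : ∀ xs d k → at (trim xs d) d k ≡ at xs d k
  at-trim []       d k       = refl
  at-trim (x ∷ xs) d zero    = at-consTrim x (trim xs d) d zero
  at-trim (x ∷ xs) d (suc k) = trans (at-consTrim x (trim xs d) d (suc k)) (at-trim xs d k)

  consTrim-trimmed : ∀ x ys d → Trimmed ys d → Trimmed (consTrim x ys d) d
  consTrim-trimmed x []       d _ with x ≟ d
  ... | yes _ = refl
  ... | no x≢d with x ≟ d
  ...   | yes x≡d = ⊥-elim (x≢d x≡d)
  ...   | no _    = refl
  consTrim-trimmed x (y ∷ ys) d t = cong (λ zs → consTrim x zs d) t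

  trim-trimmed : ∀ xs d → Trimmed (trim xs d) d
  trim-trimmed []       d = refl
  trim-trimmed (x ∷ xs) d = consTrim-trimmed x (trim xs d) d (trim-trimmed xs d)

  trim-default : ∀ xs d → (∀ k → at xs d k ≡ d) → trim xs d ≡ []
  trim-default []       d _   = refl
  trim-default (x ∷ xs) d all rewrite trim-default xs d (λ k → all (suc k)) with x ≟ d
  ... | yes _   = refl
  ... | no x≢d = ⊥-elim (x≢d (all zero))

  trimmed-tail : ∀ x xs d → Trimmed (x ∷ xs) d → Trimmed xs d
  trimmed-tail x xs d t with trim xs d
  ... | y ∷ ys = ∷-injectiveʳ t
  ... | [] with x ≟ d
  ...   | no _ = ∷-injectiveʳ t

  trimmed-unique : ∀ xs ys d → Trimmed xs d → Trimmed ys d →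
                   (∀ k → at xs d k ≡ at ys d k) → xs ≡ ys
  trimmed-unique []       []       d _  _  _  = refl
  trimmed-unique []       (y ∷ ys) d _  ty eq = trans (sym (trim-default (y ∷ ys) d (λ k → sym (eq k)))) ty
  trimmed-unique (x ∷ xs) []       d tx _  eq = sym (trans (sym (trim-default (x ∷ xs) d eq)) tx)
  trimmed-unique (x ∷ xs) (y ∷ ys) d tx ty eq =
    cong₂ _∷_ (eq zero) (trimmed-unique xs ys d (trimmed-tail x xs d tx) (trimmed-tail y ys d ty) (λ k → eq (suc k)))

module FinCof where

  open import Data.Nat using (ℕ; zero; suc; _≤_; z≤n; s≤s; _⊔_; _≤′_; ≤′-refl; ≤′-step)
  open import Data.Nat.Properties using (≤-refl; m≤m⊔n; m≤n⊔m; ≤⇒≤′; ≤′⇒≤)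
  open import Data.Bool using (Bool)
  import Data.Bool.Properties as Bool
  open import Data.List using (List; []; _∷_; length)
  import Data.List.Properties as List
  open import Data.Product using (Σ; _×_; _,_; proj₁; proj₂)
  import Data.Product.Properties as Product
  open import Relation.Nullary using (yes; no)
  open import Relation.Binary.Definitions using (DecidableEquality)
  open import Relation.Binary.PropositionalEquality using (_≡_; refl; sym; trans; cong; cong₂; subst)
  import Axiom.UniquenessOfIdentityProofs as UIP

  open Trimming Bool._≟_ public

  -- Finite-or-cofinite subsets of ℕ, i.e. eventually constant boolean sequences,
  -- in their unique trimmed representation.
  FinCof : Set
  FinCof = Σ (List Bool × Bool) (λ (xs , d) → Trimmed xs d)

  mem : FinCof → ℕ → Bool
  mem ((xs , d) , _) = at xs d

  bound : FinCof → ℕ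
  bound ((xs , _) , _) = length xs

  mem-beyond : ∀ P k → bound P ≤ k → mem P k ≡ mem P (bound P)
  mem-beyond ((xs , d) , _) k le = trans (at-beyond xs d k le) (sym (at-beyond xs d (length xs) ≤-refl))

  -- Equality of representations only depends on the data, by uniqueness of
  -- identity proofs for lists with decidable equality.
  FinCof-≡ : ∀ {r s : List Bool × Bool} (r≡s : r ≡ s) (t : Trimmed (proj₁ r) (proj₂ r)) (u : Trimmed (proj₁ s) (proj₂ s)) →
             _≡_ {A = FinCof} (r , t) (s , u)
  FinCof-≡ refl t u = cong (_ ,_) (UIP.Decidable⇒UIP.≡-irrelevant (List.≡-dec Bool._≟_) t u)

  FinCof-ext : ∀ P Q → (∀ k → mem P k ≡ mem Q k) → P ≡ Q
  FinCof-ext ((xs , d) , t) ((ys , e) , u) P≗Q = FinCof-≡ (cong₂ _,_ xs≡ys d≡e) t u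
    where
      m : ℕ
      m = length xs ⊔ length ys
      d≡e : d ≡ e
      d≡e = trans (sym (at-beyond xs d m (m≤m⊔n _ _))) (trans (P≗Q m) (at-beyond ys e m (m≤n⊔m _ _)))
      xs≡ys : xs ≡ ys
      xs≡ys = trimmed-unique xs ys d t (subst (Trimmed ys) (sym d≡e) u)
                (λ k → trans (P≗Q k) (cong (λ z → at ys z k) (sym d≡e)))

  -- decidable equality, so that lists of rows can themselves be trimmed
  _≟FC_ : DecidableEquality FinCof
  P ≟FC Q with Product.≡-dec (List.≡-dec Bool._≟_) Bool._≟_ (proj₁ P) (proj₁ Q)
  ... | yes P≡Q = yes (FinCof-≡ P≡Q (proj₂ P) (proj₂ Q))
  ... | no  P≢Q = no (λ e → P≢Q (cong proj₁ e))

  prefix : (ℕ → Bool) → ℕ → List Bool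
  prefix f zero    = []
  prefix f (suc K) = f 0 ∷ prefix (λ k → f (suc k)) K

  at-prefix : ∀ f K → (∀ k → K ≤ k → f k ≡ f K) → ∀ k → at (prefix f K) (f K) k ≡ f k
  at-prefix f zero    const k       = sym (const k z≤n)
  at-prefix f (suc K) const zero    = refl
  at-prefix f (suc K) const (suc k) = at-prefix (λ k → f (suc k)) K (λ k le → const (suc k) (s≤s le)) k

  abstract
    fromFun : (ℕ → Bool) → ℕ → FinCof
    fromFun f K = (trim (prefix f K) (f K) , f K) , trim-trimmed (prefix f K) (f K)

    mem-fromFun : ∀ f K → (∀ k → K ≤ k → f k ≡ f K) → ∀ k → mem (fromFun f K) k ≡ f k
    mem-fromFun f K const k = trans (at-trim (prefix f K) (f K) k) (at-prefix f K const k)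

  constant-from : ∀ (g : ℕ → Bool) K → (∀ k → K ≤ k → g k ≡ g (suc k)) → ∀ k → K ≤ k → g k ≡ g K
  constant-from g K step k K≤k = go k (≤⇒≤′ K≤k)
    where
      go : ∀ k → K ≤′ k → g k ≡ g K
      go .K      ≤′-refl         = refl
      go (suc k) (≤′-step K≤′k) = trans (sym (step k (≤′⇒≤ K≤′k))) (go k K≤′k)

module Shapes where

  open import Data.Nat using (ℕ; zero; suc; _≤_; _<_; z≤n; s≤s; _≤ᵇ_; _≤′_; ≤′-refl; ≤′-step)
  open import Data.Nat.Properties using (≤-refl; ≤-trans; ≤-antisym; n≤1+n; ≤⇒≤′; ≰⇒>; _≤?_)
  open import Data.Bool using (Bool; true; false)
  open import Data.Maybe using (Maybe; just; nothing)
  open import Data.Product using (_×_; _,_; proj₁; proj₂)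
  open import Data.Empty using (⊥-elim)
  open import Relation.Nullary using (yes; no)
  open import Relation.Binary.PropositionalEquality using (_≡_; refl; sym; trans; cong; cong₂)
  open Booleans
  open FinCof

  -- The possible rows of a relation far out: the sets {0 | δ} ∪ [m+1, ∞)
  -- (with m = nothing meaning that the second part is empty).
  Shape : Set
  Shape = Bool × Maybe ℕ

  shapeFun : Shape → ℕ → Bool
  shapeFun (δ , _)      zero    = δ
  shapeFun (_ , nothing) (suc k) = false
  shapeFun (_ , just m)  (suc k) = m ≤ᵇ k

  shapeBound : Shape → ℕ
  shapeBound (_ , nothing) = 1
  shapeBound (_ , just m)  = suc m

  shape-const : ∀ t k → shapeBound t ≤ k → shapeFun t k ≡ shapeFun t (shapeBound t)
  shape-const (_ , nothing) (suc k) _         = refl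
  shape-const (_ , just m)  (suc k) (s≤s m≤k) = trans (≤ᵇ-complete m≤k) (sym (≤ᵇ-complete (≤-refl {m})))

  -- Upward closure away from 0: the property that lets consecutive steps in the
  -- far region be merged into one step.
  UpClosed : (ℕ → Bool) → Set
  UpClosed f = ∀ k → 1 ≤ k → f k ≡ true → f (suc k) ≡ true

  shape-upClosed : ∀ t → UpClosed (shapeFun t)
  shape-upClosed (_ , nothing) (suc k) _ ()
  shape-upClosed (_ , just m)  (suc k) _ e = ≤ᵇ-complete (≤-trans (≤ᵇ-sound m k e) (n≤1+n k))

  upClosed-iter : ∀ f → UpClosed f → ∀ m k → m ≤ k → f (suc m) ≡ true → f (suc k) ≡ true
  upClosed-iter f up m k m≤k = go k (≤⇒≤′ m≤k)
    where
      go : ∀ k → m ≤′ k → f (suc m) ≡ true → f (suc k) ≡ true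
      go .m      ≤′-refl        e = e
      go (suc k) (≤′-step m≤′k) e = up (suc k) (s≤s z≤n) (go k m≤′k e)

  toFinCof : Shape → FinCof
  toFinCof t = fromFun (shapeFun t) (shapeBound t)

  mem-toFinCof : ∀ t k → mem (toFinCof t) k ≡ shapeFun t k
  mem-toFinCof t = mem-fromFun (shapeFun t) (shapeBound t) (shape-const t)

  shape-injective : ∀ t u → (∀ k → shapeFun t k ≡ shapeFun u k) → t ≡ u
  shape-injective (δ , nothing) (ε , nothing) t≗u = cong (_, nothing) (t≗u 0)
  shape-injective (δ , nothing) (ε , just n)  t≗u = ⊥-elim (false≢true (trans (t≗u (suc n)) (≤ᵇ-complete (≤-refl {n}))))
  shape-injective (δ , just m)  (ε , nothing) t≗u = ⊥-elim (false≢true (trans (sym (t≗u (suc m))) (≤ᵇ-complete (≤-refl {m}))))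
  shape-injective (δ , just m)  (ε , just n)  t≗u = cong₂ _,_ (t≗u 0) (cong just (≤-antisym m≤n n≤m))
    where
      m≤n : m ≤ n
      m≤n = ≤ᵇ-sound m n (trans (t≗u (suc n)) (≤ᵇ-complete (≤-refl {n})))
      n≤m : n ≤ m
      n≤m = ≤ᵇ-sound n m (trans (sym (t≗u (suc m))) (≤ᵇ-complete (≤-refl {m})))

  firstTrue : (ℕ → Bool) → ℕ → Maybe ℕ
  firstTrue g zero = nothing
  firstTrue g (suc n) with g 0
  ... | true  = just 0
  ... | false with firstTrue (λ j → g (suc j)) n
  ...   | just m  = just (suc m)
  ...   | nothing = nothing

  firstTrue-just : ∀ g n m → firstTrue g n ≡ just m → (g m ≡ true) × (∀ j → j < m → g j ≡ false)
  firstTrue-just g (suc n) m e with g 0 in g0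
  firstTrue-just g (suc n) .0 refl | true = g0 , λ _ ()
  ... | false with firstTrue (λ j → g (suc j)) n in rest
  firstTrue-just g (suc n) .(suc m) refl | false | just m with firstTrue-just (λ j → g (suc j)) n m rest
  ...   | gm , before = gm , below
    where
      below : ∀ j → j < suc m → g j ≡ false
      below zero    _         = g0
      below (suc j) (s≤s j<m) = before j j<m

  firstTrue-nothing : ∀ g n → firstTrue g n ≡ nothing → ∀ j → j < n → g j ≡ false
  firstTrue-nothing g (suc n) e j j<n with g 0 in g0
  firstTrue-nothing g (suc n) () j j<n | true
  ... | false with firstTrue (λ j → g (suc j)) n in rest
  firstTrue-nothing g (suc n) () j j<n | false | just m
  firstTrue-nothing g (suc n) e zero    _         | false | nothing = g0
  firstTrue-nothing g (suc n) e (suc j) (s≤s j<n) | false | nothing = firstTrue-nothing (λ j → g (suc j)) n rest j j<n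

  shapeOf : (ℕ → Bool) → ℕ → Shape
  shapeOf f K = f 0 , firstTrue (λ j → f (suc j)) (suc K)

  shapeOf-correct : ∀ f K → (∀ k → K ≤ k → f k ≡ f K) → UpClosed f → ∀ k → shapeFun (shapeOf f K) k ≡ f k
  shapeOf-correct f K const up zero = refl
  shapeOf-correct f K const up (suc k) with firstTrue (λ j → f (suc j)) (suc K) in e
  ... | just m = true-ext (λ m≤k → upClosed-iter f up m k (≤ᵇ-sound m k m≤k) fm) reached
    where
      fm : f (suc m) ≡ true
      fm = proj₁ (firstTrue-just (λ j → f (suc j)) (suc K) m e)
      reached : f (suc k) ≡ true → (m ≤ᵇ k) ≡ true
      reached fk with m ≤? k
      ... | yes m≤k = ≤ᵇ-complete m≤k
      ... | no  m≰k = ⊥-elim (false≢true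
              (trans (sym (proj₂ (firstTrue-just (λ j → f (suc j)) (suc K) m e) k (≰⇒> m≰k))) fk))
  ... | nothing with k ≤? K
  ...   | yes k≤K = sym (firstTrue-nothing (λ j → f (suc j)) (suc K) e k (s≤s k≤K))
  ...   | no  k≰K = sym (trans (const (suc k) (≤-trans (n≤1+n K) (≤-trans (≰⇒> k≰K) (n≤1+n k))))
                        (trans (sym (const (suc K) (n≤1+n K))) (firstTrue-nothing (λ j → f (suc j)) (suc K) e K ≤-refl)))

module Relations where

  open import Data.Nat using (ℕ; zero; suc; _≤_; _<_; s≤s; _⊔_)
  open import Data.Nat.Properties using (≤-refl; ≤-trans; m≤m⊔n; m≤n⊔m; ≰⇒>; _≤?_)
  open import Data.Bool using (Bool)
  open import Data.List using (List; []; _∷_; length)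
  import Data.List.Properties as List
  open import Data.Product using (Σ; _×_; _,_; proj₁; proj₂)
  open import Relation.Nullary using (yes; no)
  open import Relation.Binary.PropositionalEquality using (_≡_; refl; sym; trans; cong; cong₂; subst)
  import Axiom.UniquenessOfIdentityProofs as UIP
  open FinCof
  open Shapes

  -- lists of rows, trimmed with respect to the row repeated forever
  module Rows = Trimming _≟FC_

  -- Binary relations on ℕ viewed as  x ↦ set of offsets k  with (x , x + k) related.
  BinRel : Set
  BinRel = ℕ → ℕ → Bool

  Regular : BinRel → ℕ → ℕ → Set
  Regular G N K = (∀ x k → N ≤ x → G x k ≡ G N k) × (∀ x k → K ≤ k → G x k ≡ G x K)

  regular-weaken : ∀ {G N K} N′ K′ → N ≤ N′ → K ≤ K′ → Regular G N K → Regular G N′ K′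
  regular-weaken N′ K′ N≤N′ K≤K′ (rows , cols) =
    (λ x k N′≤x → trans (rows x k (≤-trans N≤N′ N′≤x)) (sym (rows N′ k N≤N′))) ,
    (λ x k K′≤k → trans (cols x k (≤-trans K≤K′ K′≤k)) (sym (cols x K′ K≤K′)))

  -- The carrier of the model: regular relations whose common far row is up-closed
  -- (a shape), represented by finitely many rows and the shape of all later rows.
  Rel : Set
  Rel = Σ (List FinCof × Shape) (λ (rs , t) → Rows.Trimmed rs (toFinCof t))

  abstract
    row : Rel → ℕ → FinCof
    row ((rs , t) , _) = Rows.at rs (toFinCof t)

    ⟦_⟧ : Rel → BinRel
    ⟦ r ⟧ x k = mem (row r x) k

    rowBound : Rel → ℕ
    rowBound ((rs , _) , _) = length rs

    tailShape : Rel → Shape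
    tailShape ((_ , t) , _) = t

    maxBound : List FinCof → ℕ → ℕ
    maxBound []       b = b
    maxBound (P ∷ ps) b = bound P ⊔ maxBound ps b

    offsetBound : Rel → ℕ
    offsetBound ((rs , t) , _) = maxBound rs (bound (toFinCof t))

    maxBound-at : ∀ rs d x → bound (Rows.at rs d x) ≤ maxBound rs (bound d)
    maxBound-at []       d x       = ≤-refl
    maxBound-at (P ∷ rs) d zero    = m≤m⊔n _ _
    maxBound-at (P ∷ rs) d (suc x) = ≤-trans (maxBound-at rs d x) (m≤n⊔m _ _)

    ⟦⟧-far : ∀ r x k → rowBound r ≤ x → ⟦ r ⟧ x k ≡ shapeFun (tailShape r) k
    ⟦⟧-far ((rs , t) , _) x k le = trans (cong (λ P → mem P k) (Rows.at-beyond rs (toFinCof t) x le)) (mem-toFinCof t k)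

    regular : ∀ r → Regular ⟦ r ⟧ (rowBound r) (offsetBound r)
    regular r@((rs , t) , _) = rows , cols
      where
        rows : ∀ x k → rowBound r ≤ x → ⟦ r ⟧ x k ≡ ⟦ r ⟧ (rowBound r) k
        rows x k le = trans (⟦⟧-far r x k le) (sym (⟦⟧-far r (rowBound r) k ≤-refl))
        cols : ∀ x k → offsetBound r ≤ k → ⟦ r ⟧ x k ≡ ⟦ r ⟧ x (offsetBound r)
        cols x k le = trans (mem-beyond (row r x) k (≤-trans (maxBound-at rs (toFinCof t) x) le))
                            (sym (mem-beyond (row r x) (offsetBound r) (maxBound-at rs (toFinCof t) x)))

    upClosed-far : ∀ r x → rowBound r ≤ x → UpClosed (⟦ r ⟧ x)
    upClosed-far r x le k 1≤k e =
      trans (⟦⟧-far r x (suc k) le) (shape-upClosed (tailShape r) k 1≤k (trans (sym (⟦⟧-far r x k le)) e))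

    Rel-≡ : ∀ {a b : List FinCof × Shape} (a≡b : a ≡ b)
            (t : Rows.Trimmed (proj₁ a) (toFinCof (proj₂ a))) (u : Rows.Trimmed (proj₁ b) (toFinCof (proj₂ b))) →
            _≡_ {A = Rel} (a , t) (b , u)
    Rel-≡ refl t u = cong (_ ,_) (UIP.Decidable⇒UIP.≡-irrelevant (List.≡-dec _≟FC_) t u)

    Rel-ext : ∀ r s → (∀ x k → ⟦ r ⟧ x k ≡ ⟦ s ⟧ x k) → r ≡ s
    Rel-ext r@((rs , t) , τ) s@((ss , u) , υ) r≗s = Rel-≡ (cong₂ _,_ rs≡ss t≡u) τ υ
      where
        m : ℕ
        m = length rs ⊔ length ss
        t≡u : t ≡ u
        t≡u = shape-injective t u (λ k → trans (sym (⟦⟧-far r m k (m≤m⊔n _ _))) (trans (r≗s m k) (⟦⟧-far s m k (m≤n⊔m _ _))))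
        rs≡ss : rs ≡ ss
        rs≡ss = Rows.trimmed-unique rs ss (toFinCof t) τ (subst (λ z → Rows.Trimmed ss (toFinCof z)) (sym t≡u) υ)
                  (λ x → trans (FinCof-ext (row r x) (row s x) (r≗s x)) (cong (λ z → Rows.at ss (toFinCof z) x) (sym t≡u)))

    tabulate : {A : Set} → (ℕ → A) → ℕ → List A
    tabulate f zero    = []
    tabulate f (suc N) = f 0 ∷ tabulate (λ x → f (suc x)) N

    at-tabulate< : ∀ (f : ℕ → FinCof) N d x → x < N → Rows.at (tabulate f N) d x ≡ f x
    at-tabulate< f (suc N) d zero    _         = refl
    at-tabulate< f (suc N) d (suc x) (s≤s x<N) = at-tabulate< (λ x → f (suc x)) N d x x<N

    at-tabulate≥ : ∀ (f : ℕ → FinCof) N d x → N ≤ x → Rows.at (tabulate f N) d x ≡ d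
    at-tabulate≥ f zero    d x       _         = refl
    at-tabulate≥ f (suc N) d (suc x) (s≤s N≤x) = at-tabulate≥ (λ x → f (suc x)) N d x N≤x

    fromRegular : BinRel → ℕ → ℕ → Rel
    fromRegular G N K = (Rows.trim rows (toFinCof t) , t) , Rows.trim-trimmed rows (toFinCof t)
      where
        t : Shape
        t = shapeOf (G N) K
        rows : List FinCof
        rows = tabulate (λ x → fromFun (G x) K) N

    ⟦⟧-fromRegular : ∀ G N K → Regular G N K → UpClosed (G N) → ∀ x k → ⟦ fromRegular G N K ⟧ x k ≡ G x k
    ⟦⟧-fromRegular G N K (rows , cols) up x k = trans (cong (λ P → mem P k) (Rows.at-trim rowList d x)) byRow
      where
        t : Shape
        t = shapeOf (G N) K
        d : FinCof
        d = toFinCof t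
        rowList : List FinCof
        rowList = tabulate (λ x → fromFun (G x) K) N
        byRow : mem (Rows.at rowList d x) k ≡ G x k
        byRow with suc x ≤? N
        ... | yes x<N = trans (cong (λ P → mem P k) (at-tabulate< (λ x → fromFun (G x) K) N d x x<N))
                              (mem-fromFun (G x) K (cols x) k)
        ... | no  x≮N = trans (cong (λ P → mem P k) (at-tabulate≥ (λ x → fromFun (G x) K) N d x N≤x))
                        (trans (mem-toFinCof t k) (trans (shapeOf-correct (G N) K (cols N) up k) (sym (rows x k N≤x))))
          where
            N≤x : N ≤ x
            N≤x with ≰⇒> x≮N
            ... | s≤s N≤x = N≤x

    fromShape : Shape → Rel
    fromShape t = ([] , t) , refl

    ⟦⟧-fromShape : ∀ t x k → ⟦ fromShape t ⟧ x k ≡ shapeFun t k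
    ⟦⟧-fromShape t x k = mem-toFinCof t k

module Composition where

  open import Data.Nat using (ℕ; zero; suc; _≤_; z≤n; s≤s; _+_; _∸_)
  open import Data.Nat.Properties
  open import Data.Bool using (true; _∧_)
  open import Data.Product using (Σ; _×_; _,_; proj₁; proj₂)
  open import Relation.Nullary using (yes; no)
  open import Relation.Binary.PropositionalEquality using (_≡_; refl; sym; trans; cong; cong₂; subst)
  open Booleans
  open FinCof
  open Shapes
  open Relations

  compose : BinRel → BinRel → BinRel
  compose A B x k = anyUpTo k (λ i → A x i ∧ B (x + i) (k ∸ i))

  Path : BinRel → BinRel → ℕ → ℕ → Set
  Path A B x k = Σ ℕ (λ i → Σ ℕ (λ j → (i + j ≡ k) × (A x i ≡ true) × (B (x + i) j ≡ true)))

  compose-elim : ∀ A B x k → compose A B x k ≡ true → Path A B x k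
  compose-elim A B x k e with anyUpTo-elim k (λ i → A x i ∧ B (x + i) (k ∸ i)) e
  ... | i , i≤k , ab = i , k ∸ i , m+[n∸m]≡n i≤k , ∧-elimˡ (A x i) ab , ∧-elimʳ (A x i) ab

  compose-intro : ∀ A B x k → Path A B x k → compose A B x k ≡ true
  compose-intro A B x k (i , j , refl , a , b) =
    anyUpTo-intro k (λ i → A x i ∧ B (x + i) (k ∸ i)) i (m≤m+n i j)
      (∧-intro a (subst (λ z → B (x + i) z ≡ true) (sym (m+n∸m≡n i j)) b))

  split-long : ∀ {i j k m K} → i + j ≡ k → m + K ≤ k → j ≤ K → m ≤ i
  split-long {i} {j} {k} {m} {K} i+j≡k m+K≤k j≤K =
    +-cancelʳ-≤ K m i (≤-trans m+K≤k (subst (_≤ i + K) i+j≡k (+-monoʳ-≤ i j≤K)))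

  -- The composite of two regular relations is regular; offsets beyond N + K + K
  -- can be lengthened or shortened by one inside one of the two constant regions.
  module ComposeRegular (A B : BinRel) (N K : ℕ) (regA : Regular A N K) (regB : Regular B N K) where

    private
      rowsA : ∀ x k → N ≤ x → A x k ≡ A N k
      rowsA = proj₁ regA
      colsA : ∀ x k → K ≤ k → A x k ≡ A x K
      colsA = proj₂ regA
      rowsB : ∀ x k → N ≤ x → B x k ≡ B N k
      rowsB = proj₁ regB
      colsB : ∀ x k → K ≤ k → B x k ≡ B x K
      colsB = proj₂ regB

    compBound : ℕ
    compBound = N + K + K

    B-stretch : ∀ y j → K ≤ j → B y j ≡ B y (suc j)
    B-stretch y j K≤j = trans (colsB y j K≤j) (sym (colsB y (suc j) (≤-trans K≤j (n≤1+n j))))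

    A-stretch : ∀ x i j → N + K ≤ i → A x i ≡ true → B (x + i) j ≡ true →
                (A x (suc i) ≡ true) × (B (x + suc i) j ≡ true)
    A-stretch x i j N+K≤i a b =
      trans (colsA x (suc i) (≤-trans K≤i (n≤1+n i))) (trans (sym (colsA x i K≤i)) a) ,
      trans (rowsB (x + suc i) j (≤-trans N≤x+i (+-monoʳ-≤ x (n≤1+n i)))) (trans (sym (rowsB (x + i) j N≤x+i)) b)
      where
        K≤i : K ≤ i
        K≤i = ≤-trans (m≤n+m K N) N+K≤i
        N≤x+i : N ≤ x + i
        N≤x+i = ≤-trans (≤-trans (m≤m+n N K) N+K≤i) (m≤n+m i x)

    A-shrink : ∀ x i j → N + K ≤ i → A x (suc i) ≡ true → B (x + suc i) j ≡ true →
               (A x i ≡ true) × (B (x + i) j ≡ true)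
    A-shrink x i j N+K≤i a b =
      trans (colsA x i K≤i) (trans (sym (colsA x (suc i) (≤-trans K≤i (n≤1+n i)))) a) ,
      trans (rowsB (x + i) j N≤x+i) (trans (sym (rowsB (x + suc i) j (≤-trans N≤x+i (+-monoʳ-≤ x (n≤1+n i))))) b)
      where
        K≤i : K ≤ i
        K≤i = ≤-trans (m≤n+m K N) N+K≤i
        N≤x+i : N ≤ x + i
        N≤x+i = ≤-trans (≤-trans (m≤m+n N K) N+K≤i) (m≤n+m i x)

    compose-rows : ∀ x k → N ≤ x → compose A B x k ≡ compose A B N k
    compose-rows x k N≤x = true-ext
      (λ e → let (i , j , s , a , b) = compose-elim A B x k e in
        compose-intro A B N k (i , j , s , trans (sym (rowsA x i N≤x)) a ,
          trans (rowsB (N + i) j (m≤m+n N i)) (trans (sym (rowsB (x + i) j (≤-trans N≤x (m≤m+n x i)))) b)))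
      (λ e → let (i , j , s , a , b) = compose-elim A B N k e in
        compose-intro A B x k (i , j , s , trans (rowsA x i N≤x) a ,
          trans (rowsB (x + i) j (≤-trans N≤x (m≤m+n x i))) (trans (sym (rowsB (N + i) j (m≤m+n N i))) b)))

    compose-grow : ∀ x k → compBound ≤ k → compose A B x k ≡ true → compose A B x (suc k) ≡ true
    compose-grow x k big e with compose-elim A B x k e
    ... | i , j , s , a , b with K ≤? j
    ...   | yes K≤j = compose-intro A B x (suc k)
                        (i , suc j , trans (+-suc i j) (cong suc s) , a , trans (sym (B-stretch (x + i) j K≤j)) b)
    ...   | no  K≰j = let (a′ , b′) = A-stretch x i j (split-long s big (<⇒≤ (≰⇒> K≰j))) a b in
                      compose-intro A B x (suc k) (suc i , j , cong suc s , a′ , b′)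

    compose-shrink : ∀ x k → compBound ≤ k → compose A B x (suc k) ≡ true → compose A B x k ≡ true
    compose-shrink x k big e with compose-elim A B x (suc k) e
    ... | i , j , s , a , b with K <? j
    compose-shrink x k big e | i , suc j , s , a , b | yes (s≤s K≤j) =
      compose-intro A B x k (i , j , suc-injective (trans (sym (+-suc i j)) s) , a , trans (B-stretch (x + i) j K≤j) b)
    compose-shrink x k big e | zero , j , s , a , b | no K≮j with split-long {m = suc (N + K)} s (s≤s big) (≮⇒≥ K≮j)
    ... | ()
    compose-shrink x k big e | suc i , j , s , a , b | no K≮j =
      let (a′ , b′) = A-shrink x i j (≤-pred (split-long {m = suc (N + K)} s (s≤s big) (≮⇒≥ K≮j))) a b in
      compose-intro A B x k (i , j , suc-injective s , a′ , b′)

    compose-regular : Regular (compose A B) N compBound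
    compose-regular = compose-rows , λ x → constant-from (compose A B x) compBound
                        (λ k big → true-ext (compose-grow x k big) (compose-shrink x k big))

    -- the far row of a composite of up-closed far rows is up-closed: lengthen the
    -- second step, or the first one if the second is empty
    compose-upClosed : UpClosed (A N) → UpClosed (B N) → UpClosed (compose A B N)
    compose-upClosed upA upB k 1≤k e with compose-elim A B N k e
    ... | i , suc j , s , a , b =
      compose-intro A B N (suc k) (i , suc (suc j) , trans (+-suc i (suc j)) (cong suc s) , a ,
        trans (rowsB (N + i) (suc (suc j)) (m≤m+n N i)) (upB (suc j) (s≤s z≤n) (trans (sym (rowsB (N + i) (suc j) (m≤m+n N i))) b)))
    ... | i , zero , s , a , b =
      compose-intro A B N (suc k) (suc i , zero , cong suc s ,
        upA i (subst (1 ≤_) (sym (trans (sym (+-identityʳ i)) s)) 1≤k) a ,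
        trans (rowsB (N + suc i) zero (m≤m+n N (suc i))) (trans (sym (rowsB (N + i) zero (m≤m+n N i))) b))

module Operations where

  open import Data.Nat using (ℕ; zero; suc; _⊔_)
  open import Data.Nat.Properties using (m≤m⊔n; m≤n⊔m)
  open import Data.Bool using (true; false; _∨_)
  open import Data.Maybe using (just; nothing)
  open import Data.Product using (_,_)
  open import Data.Sum using (inj₁; inj₂)
  open import Relation.Binary.PropositionalEquality using (_≡_; cong₂)
  open Booleans
  open Shapes
  open Relations
  open Composition

  union : BinRel → BinRel → BinRel
  union G H x k = G x k ∨ H x k

  union-regular : ∀ {G H N K} → Regular G N K → Regular H N K → Regular (union G H) N K
  union-regular (rowsG , colsG) (rowsH , colsH) =
    (λ x k le → cong₂ _∨_ (rowsG x k le) (rowsH x k le)) , (λ x k le → cong₂ _∨_ (colsG x k le) (colsH x k le))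

  union-upClosed : ∀ {G H N} → UpClosed (G N) → UpClosed (H N) → UpClosed (union G H N)
  union-upClosed {G} {H} {N} upG upH k 1≤k e with ∨-elim (G N k) e
  ... | inj₁ g = ∨-introˡ (H N (suc k)) (upG k 1≤k g)
  ... | inj₂ h = ∨-introʳ (G N (suc k)) (upH k 1≤k h)

  private
    N₂ : Rel → Rel → ℕ
    N₂ r s = rowBound r ⊔ rowBound s

    K₂ : Rel → Rel → ℕ
    K₂ r s = offsetBound r ⊔ offsetBound s

    regularˡ : ∀ r s → Regular ⟦ r ⟧ (N₂ r s) (K₂ r s)
    regularˡ r s = regular-weaken (N₂ r s) (K₂ r s) (m≤m⊔n _ _) (m≤m⊔n _ _) (regular r)

    regularʳ : ∀ r s → Regular ⟦ s ⟧ (N₂ r s) (K₂ r s)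
    regularʳ r s = regular-weaken (N₂ r s) (K₂ r s) (m≤n⊔m _ _) (m≤n⊔m _ _) (regular s)

    upClosedˡ : ∀ r s → UpClosed (⟦ r ⟧ (N₂ r s))
    upClosedˡ r s = upClosed-far r (N₂ r s) (m≤m⊔n _ _)

    upClosedʳ : ∀ r s → UpClosed (⟦ s ⟧ (N₂ r s))
    upClosedʳ r s = upClosed-far s (N₂ r s) (m≤n⊔m _ _)

  infixl 6 _⊕_
  infixl 7 _⊗_

  abstract
    _⊕_ : Rel → Rel → Rel
    r ⊕ s = fromRegular (union ⟦ r ⟧ ⟦ s ⟧) (N₂ r s) (K₂ r s)

    ⟦⊕⟧ : ∀ r s x k → ⟦ r ⊕ s ⟧ x k ≡ ⟦ r ⟧ x k ∨ ⟦ s ⟧ x k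
    ⟦⊕⟧ r s = ⟦⟧-fromRegular (union ⟦ r ⟧ ⟦ s ⟧) (N₂ r s) (K₂ r s)
      (union-regular (regularˡ r s) (regularʳ r s)) (union-upClosed {⟦ r ⟧} {⟦ s ⟧} (upClosedˡ r s) (upClosedʳ r s))

    _⊗_ : Rel → Rel → Rel
    r ⊗ s = fromRegular (compose ⟦ r ⟧ ⟦ s ⟧) (N₂ r s) (ComposeRegular.compBound ⟦ r ⟧ ⟦ s ⟧ (N₂ r s) (K₂ r s) (regularˡ r s) (regularʳ r s))

    ⟦⊗⟧ : ∀ r s x k → ⟦ r ⊗ s ⟧ x k ≡ compose ⟦ r ⟧ ⟦ s ⟧ x k
    ⟦⊗⟧ r s = ⟦⟧-fromRegular (compose ⟦ r ⟧ ⟦ s ⟧) (N₂ r s) _ compose-regular (compose-upClosed (upClosedˡ r s) (upClosedʳ r s))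
      where open ComposeRegular ⟦ r ⟧ ⟦ s ⟧ (N₂ r s) (K₂ r s) (regularˡ r s) (regularʳ r s)

  -- The constants: the empty relation, the identity, all pairs x ≤ y, and x < y.
  zeroR oneR topR ltR : Rel
  zeroR = fromShape (false , nothing)
  oneR  = fromShape (true , nothing)
  topR  = fromShape (true , just 0)
  ltR   = fromShape (false , just 0)

  oneF : BinRel
  oneF  _ zero    = true
  oneF  _ (suc k) = false

  ⟦zero⟧ : ∀ x k → ⟦ zeroR ⟧ x k ≡ false
  ⟦zero⟧ x zero    = ⟦⟧-fromShape (false , nothing) x zero
  ⟦zero⟧ x (suc k) = ⟦⟧-fromShape (false , nothing) x (suc k)

  ⟦one⟧ : ∀ x k → ⟦ oneR ⟧ x k ≡ oneF x k
  ⟦one⟧ x zero    = ⟦⟧-fromShape (true , nothing) x zero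
  ⟦one⟧ x (suc k) = ⟦⟧-fromShape (true , nothing) x (suc k)

  ⟦top⟧ : ∀ x k → ⟦ topR ⟧ x k ≡ true
  ⟦top⟧ x zero    = ⟦⟧-fromShape (true , just 0) x zero
  ⟦top⟧ x (suc k) = ⟦⟧-fromShape (true , just 0) x (suc k)

  ⟦lt⟧-zero : ∀ x → ⟦ ltR ⟧ x 0 ≡ false
  ⟦lt⟧-zero x = ⟦⟧-fromShape (false , just 0) x 0

  ⟦lt⟧-one : ∀ x → ⟦ ltR ⟧ x 1 ≡ true
  ⟦lt⟧-one x = ⟦⟧-fromShape (false , just 0) x 1

module Laws where

  open import Data.Nat using (zero; suc; _+_)
  open import Data.Nat.Properties using (+-assoc; +-identityʳ)
  open import Data.Bool using (Bool; true; false; _∨_)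
  import Data.Bool.Properties as Bool
  open import Data.Product using (_,_)
  open import Data.Sum using (_⊎_; inj₁; inj₂; [_,_]′)
  open import Data.Empty using (⊥-elim)
  open import Relation.Binary.PropositionalEquality using (_≡_; refl; sym; trans; cong; subst)
  open Booleans
  open Relations
  open Composition
  open Operations

  infix 4 _⊆_
  _⊆_ : Rel → Rel → Set
  r ⊆ s = ∀ x k → ⟦ r ⟧ x k ≡ true → ⟦ s ⟧ x k ≡ true

  ⊆-antisym : ∀ {r s} → r ⊆ s → s ⊆ r → r ≡ s
  ⊆-antisym r⊆s s⊆r = Rel-ext _ _ (λ x k → true-ext (r⊆s x k) (s⊆r x k))

  ⊕-elim : ∀ r s x k → ⟦ r ⊕ s ⟧ x k ≡ true → (⟦ r ⟧ x k ≡ true) ⊎ (⟦ s ⟧ x k ≡ true)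
  ⊕-elim r s x k e = ∨-elim (⟦ r ⟧ x k) (trans (sym (⟦⊕⟧ r s x k)) e)

  ⊕-introˡ : ∀ r s x k → ⟦ r ⟧ x k ≡ true → ⟦ r ⊕ s ⟧ x k ≡ true
  ⊕-introˡ r s x k e = trans (⟦⊕⟧ r s x k) (∨-introˡ (⟦ s ⟧ x k) e)

  ⊕-introʳ : ∀ r s x k → ⟦ s ⟧ x k ≡ true → ⟦ r ⊕ s ⟧ x k ≡ true
  ⊕-introʳ r s x k e = trans (⟦⊕⟧ r s x k) (∨-introʳ (⟦ r ⟧ x k) e)

  ⊗-elim : ∀ r s x k → ⟦ r ⊗ s ⟧ x k ≡ true → Path ⟦ r ⟧ ⟦ s ⟧ x k
  ⊗-elim r s x k e = compose-elim ⟦ r ⟧ ⟦ s ⟧ x k (trans (sym (⟦⊗⟧ r s x k)) e)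

  ⊗-intro : ∀ r s x k → Path ⟦ r ⟧ ⟦ s ⟧ x k → ⟦ r ⊗ s ⟧ x k ≡ true
  ⊗-intro r s x k w = trans (⟦⊗⟧ r s x k) (compose-intro ⟦ r ⟧ ⟦ s ⟧ x k w)

  one-elim : ∀ x k → ⟦ oneR ⟧ x k ≡ true → k ≡ 0
  one-elim x zero    _ = refl
  one-elim x (suc k) e = ⊥-elim (false≢true (trans (sym (⟦one⟧ x (suc k))) e))

  one-intro : ∀ x → ⟦ oneR ⟧ x 0 ≡ true
  one-intro x = ⟦one⟧ x 0

  zero-elim : ∀ {A : Set} x k → ⟦ zeroR ⟧ x k ≡ true → A
  zero-elim x k e = ⊥-elim (false≢true (trans (sym (⟦zero⟧ x k)) e))

  ⟦⟧-at : ∀ r {x x′ k k′} → x ≡ x′ → k ≡ k′ → ⟦ r ⟧ x k ≡ true → ⟦ r ⟧ x′ k′ ≡ true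
  ⟦⟧-at r refl refl e = e

  ⊕-assoc : ∀ r s t → (r ⊕ s) ⊕ t ≡ r ⊕ (s ⊕ t)
  ⊕-assoc r s t = Rel-ext _ _ λ x k →
    trans (⟦⊕⟧ (r ⊕ s) t x k) (trans (cong (_∨ ⟦ t ⟧ x k) (⟦⊕⟧ r s x k))
    (trans (Bool.∨-assoc (⟦ r ⟧ x k) (⟦ s ⟧ x k) (⟦ t ⟧ x k))
    (trans (cong (⟦ r ⟧ x k ∨_) (sym (⟦⊕⟧ s t x k))) (sym (⟦⊕⟧ r (s ⊕ t) x k)))))

  ⊕-comm : ∀ r s → r ⊕ s ≡ s ⊕ r
  ⊕-comm r s = Rel-ext _ _ λ x k → trans (⟦⊕⟧ r s x k) (trans (Bool.∨-comm (⟦ r ⟧ x k) (⟦ s ⟧ x k)) (sym (⟦⊕⟧ s r x k)))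

  ⊕-identityˡ : ∀ r → zeroR ⊕ r ≡ r
  ⊕-identityˡ r = Rel-ext _ _ λ x k → trans (⟦⊕⟧ zeroR r x k) (cong (_∨ ⟦ r ⟧ x k) (⟦zero⟧ x k))

  ⊕-idem : ∀ r → r ⊕ r ≡ r
  ⊕-idem r = Rel-ext _ _ λ x k → trans (⟦⊕⟧ r r x k) (Bool.∨-idem (⟦ r ⟧ x k))

  ⊗-assoc : ∀ r s t → (r ⊗ s) ⊗ t ≡ r ⊗ (s ⊗ t)
  ⊗-assoc r s t = ⊆-antisym to from
    where
      to : (r ⊗ s) ⊗ t ⊆ r ⊗ (s ⊗ t)
      to x k e with ⊗-elim (r ⊗ s) t x k e
      ... | i , j , refl , rs , dt with ⊗-elim r s x i rs
      ...   | i₁ , i₂ , refl , dr , ds =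
        ⊗-intro r (s ⊗ t) x (i₁ + i₂ + j) (i₁ , i₂ + j , sym (+-assoc i₁ i₂ j) , dr ,
          ⊗-intro s t (x + i₁) (i₂ + j) (i₂ , j , refl , ds , ⟦⟧-at t (sym (+-assoc x i₁ i₂)) refl dt))
      from : r ⊗ (s ⊗ t) ⊆ (r ⊗ s) ⊗ t
      from x k e with ⊗-elim r (s ⊗ t) x k e
      ... | i₁ , j′ , refl , dr , st with ⊗-elim s t (x + i₁) j′ st
      ...   | i₂ , j , refl , ds , dt =
        ⊗-intro (r ⊗ s) t x (i₁ + (i₂ + j)) (i₁ + i₂ , j , +-assoc i₁ i₂ j ,
          ⊗-intro r s x (i₁ + i₂) (i₁ , i₂ , refl , dr , ds) , ⟦⟧-at t (+-assoc x i₁ i₂) refl dt)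

  ⊗-identityˡ : ∀ r → oneR ⊗ r ≡ r
  ⊗-identityˡ r = ⊆-antisym to from
    where
      to : oneR ⊗ r ⊆ r
      to x k e with ⊗-elim oneR r x k e
      ... | i , j , s , d1 , dr with one-elim x i d1
      ...   | refl = ⟦⟧-at r (+-identityʳ x) s dr
      from : r ⊆ oneR ⊗ r
      from x k e = ⊗-intro oneR r x k (0 , k , refl , one-intro x , ⟦⟧-at r (sym (+-identityʳ x)) refl e)

  ⊗-identityʳ : ∀ r → r ⊗ oneR ≡ r
  ⊗-identityʳ r = ⊆-antisym to from
    where
      to : r ⊗ oneR ⊆ r
      to x k e with ⊗-elim r oneR x k e
      ... | i , j , s , dr , d1 with one-elim (x + i) j d1
      ...   | refl = ⟦⟧-at r refl (trans (sym (+-identityʳ i)) s) dr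
      from : r ⊆ r ⊗ oneR
      from x k e = ⊗-intro r oneR x k (k , 0 , +-identityʳ k , e , one-intro (x + k))

  distribˡ : ∀ r s t → r ⊗ (s ⊕ t) ≡ r ⊗ s ⊕ r ⊗ t
  distribˡ r s t = ⊆-antisym to from
    where
      to : r ⊗ (s ⊕ t) ⊆ r ⊗ s ⊕ r ⊗ t
      to x k e with ⊗-elim r (s ⊕ t) x k e
      ... | i , j , p , dr , st with ⊕-elim s t (x + i) j st
      ...   | inj₁ ds = ⊕-introˡ (r ⊗ s) (r ⊗ t) x k (⊗-intro r s x k (i , j , p , dr , ds))
      ...   | inj₂ dt = ⊕-introʳ (r ⊗ s) (r ⊗ t) x k (⊗-intro r t x k (i , j , p , dr , dt))
      from : r ⊗ s ⊕ r ⊗ t ⊆ r ⊗ (s ⊕ t)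
      from x k e with ⊕-elim (r ⊗ s) (r ⊗ t) x k e
      ... | inj₁ rs = let (i , j , p , dr , ds) = ⊗-elim r s x k rs in
                      ⊗-intro r (s ⊕ t) x k (i , j , p , dr , ⊕-introˡ s t (x + i) j ds)
      ... | inj₂ rt = let (i , j , p , dr , dt) = ⊗-elim r t x k rt in
                      ⊗-intro r (s ⊕ t) x k (i , j , p , dr , ⊕-introʳ s t (x + i) j dt)

  distribʳ : ∀ r s t → (s ⊕ t) ⊗ r ≡ s ⊗ r ⊕ t ⊗ r
  distribʳ r s t = ⊆-antisym to from
    where
      to : (s ⊕ t) ⊗ r ⊆ s ⊗ r ⊕ t ⊗ r
      to x k e with ⊗-elim (s ⊕ t) r x k e
      ... | i , j , p , st , dr with ⊕-elim s t x i st
      ...   | inj₁ ds = ⊕-introˡ (s ⊗ r) (t ⊗ r) x k (⊗-intro s r x k (i , j , p , ds , dr))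
      ...   | inj₂ dt = ⊕-introʳ (s ⊗ r) (t ⊗ r) x k (⊗-intro t r x k (i , j , p , dt , dr))
      from : s ⊗ r ⊕ t ⊗ r ⊆ (s ⊕ t) ⊗ r
      from x k e with ⊕-elim (s ⊗ r) (t ⊗ r) x k e
      ... | inj₁ sr = let (i , j , p , ds , dr) = ⊗-elim s r x k sr in
                      ⊗-intro (s ⊕ t) r x k (i , j , p , ⊕-introˡ s t x i ds , dr)
      ... | inj₂ tr = let (i , j , p , dt , dr) = ⊗-elim t r x k tr in
                      ⊗-intro (s ⊕ t) r x k (i , j , p , ⊕-introʳ s t x i dt , dr)

  ⊗-zeroˡ : ∀ r → zeroR ⊗ r ≡ zeroR
  ⊗-zeroˡ r = ⊆-antisym (λ x k e → let (i , _ , _ , d0 , _) = ⊗-elim zeroR r x k e in zero-elim x i d0)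
                        (λ x k → zero-elim x k)

  ⊗-zeroʳ : ∀ r → r ⊗ zeroR ≡ zeroR
  ⊗-zeroʳ r = ⊆-antisym (λ x k e → let (i , j , _ , _ , d0) = ⊗-elim r zeroR x k e in zero-elim (x + i) j d0)
                        (λ x k → zero-elim x k)

  infix 4 _⊑_
  _⊑_ : Rel → Rel → Set
  r ⊑ s = r ⊕ s ≡ s

  ⊆⇒⊑ : ∀ {r s} → r ⊆ s → r ⊑ s
  ⊆⇒⊑ {r} {s} r⊆s = ⊆-antisym (λ x k e → [ r⊆s x k , (λ d → d) ]′ (⊕-elim r s x k e)) (⊕-introʳ r s)

  ⊑⇒⊆ : ∀ {r s} → r ⊑ s → r ⊆ s
  ⊑⇒⊆ {r} {s} r⊑s x k e = subst (λ z → ⟦ z ⟧ x k ≡ true) r⊑s (⊕-introˡ r s x k e)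

module Star where

  open import Data.Nat using (ℕ; zero; suc; _≤_; z≤n; s≤s; _+_)
  open import Data.Nat.Properties
  open import Data.Bool using (true)
  open import Data.Product using (Σ; _×_; _,_)
  open import Data.Sum using (inj₁; inj₂)
  open import Data.Empty using (⊥-elim)
  open import Relation.Nullary using (yes; no)
  open import Relation.Binary.PropositionalEquality using (_≡_; refl; sym; trans; cong; subst)
  open Shapes
  open Relations
  open Operations
  open Laws

  power : Rel → ℕ → Rel
  power r zero    = oneR
  power r (suc n) = r ⊗ power r n

  power-suc-right : ∀ r n → power r (suc n) ≡ power r n ⊗ r
  power-suc-right r zero    = trans (⊗-identityʳ r) (sym (⊗-identityˡ r))
  power-suc-right r (suc n) = trans (cong (r ⊗_) (power-suc-right r n)) (sym (⊗-assoc r (power r n) r))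

  powersUpTo : Rel → ℕ → Rel
  powersUpTo r zero    = oneR
  powersUpTo r (suc n) = powersUpTo r n ⊕ power r (suc n)

  powersUpTo-intro : ∀ r M n x k → n ≤ M → ⟦ power r n ⟧ x k ≡ true → ⟦ powersUpTo r M ⟧ x k ≡ true
  powersUpTo-intro r zero    zero x k _   e = e
  powersUpTo-intro r (suc M) n    x k n≤M e with n ≟ suc M
  ... | yes refl = ⊕-introʳ (powersUpTo r M) (power r (suc M)) x k e
  ... | no  n≢M  = ⊕-introˡ (powersUpTo r M) (power r (suc M)) x k
                     (powersUpTo-intro r M n x k (≤-pred (≤∧≢⇒< n≤M n≢M)) e)

  powersUpTo-elim : ∀ r M x k → ⟦ powersUpTo r M ⟧ x k ≡ true → Σ ℕ (λ n → (n ≤ M) × (⟦ power r n ⟧ x k ≡ true))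
  powersUpTo-elim r zero    x k e = 0 , z≤n , e
  powersUpTo-elim r (suc M) x k e with ⊕-elim (powersUpTo r M) (power r (suc M)) x k e
  ... | inj₂ p = suc M , ≤-refl , p
  ... | inj₁ q with powersUpTo-elim r M x k q
  ...   | n , n≤M , p = n , ≤-trans n≤M (n≤1+n M) , p

  -- In the far region a step of positive length followed by a path can absorb
  -- the path's first step: empty steps are dropped, and two positive steps merge
  -- because far rows are up-closed.
  absorb-far : ∀ r m x i j k → rowBound r ≤ x → suc i + j ≡ k → ⟦ r ⟧ x (suc i) ≡ true →
               ⟦ r ⊗ power r m ⟧ (x + suc i) j ≡ true → ⟦ r ⊗ power r m ⟧ x k ≡ true
  absorb-far r m x i j k N≤x s d₁ rest with ⊗-elim r (power r m) (x + suc i) j rest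
  ... | zero , j₂ , s₂ , _ , p =
    ⊗-intro r (power r m) x k (suc i , j , s , d₁ , ⟦⟧-at (power r m) (+-identityʳ _) s₂ p)
  ... | suc i₂ , j₂ , s₂ , _ , p =
    ⊗-intro r (power r m) x k (suc i + suc i₂ , j₂ , lengths , merged , ⟦⟧-at (power r m) (+-assoc x (suc i) (suc i₂)) refl p)
    where
      lengths : suc i + suc i₂ + j₂ ≡ k
      lengths = trans (+-assoc (suc i) (suc i₂) j₂) (trans (cong (suc i +_) s₂) s)
      merged : ⟦ r ⟧ x (suc i + suc i₂) ≡ true
      merged = upClosed-iter (⟦ r ⟧ x) (upClosed-far r x N≤x) i (i + suc i₂) (m≤m+n i _) d₁

  -- A path of m + 2 steps from x with N ≤ m + x can be shortened by one step:
  -- walk forward until the far region is reached and absorb a step there.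
  shorten : ∀ r m x k → rowBound r ≤ m + x → ⟦ power r (2 + m) ⟧ x k ≡ true → ⟦ power r (1 + m) ⟧ x k ≡ true
  shorten r m x k N≤m+x e with ⊗-elim r (power r (suc m)) x k e
  ... | zero , j , s , _ , rest = ⟦⟧-at (power r (suc m)) (+-identityʳ x) s rest
  ... | suc i , j , s , d₁ , rest with rowBound r ≤? x
  ...   | yes N≤x = absorb-far r m x i j k N≤x s d₁ rest
  shorten r zero     x k N≤x e | suc i , j , s , d₁ , rest | no N≰x = ⊥-elim (N≰x N≤x)
  shorten r (suc m′) x k N≤m+x e | suc i , j , s , d₁ , rest | no N≰x =
    ⊗-intro r (power r (suc m′)) x k (suc i , j , s , d₁ , shorten r m′ (x + suc i) j N≤m′+x′ rest)
    where
      N≤m′+x′ : rowBound r ≤ m′ + (x + suc i)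
      N≤m′+x′ = ≤-trans N≤m+x (≤-trans (≤-reflexive (sym (+-suc m′ x)))
                  (+-monoʳ-≤ m′ (≤-trans (s≤s (m≤m+n x i)) (≤-reflexive (sym (+-suc x i))))))

  -- hence every path has at most N + 1 steps
  starBound : Rel → ℕ
  starBound r = suc (rowBound r)

  reduce : ∀ r n x k → ⟦ power r n ⟧ x k ≡ true → Σ ℕ (λ n′ → (n′ ≤ starBound r) × (⟦ power r n′ ⟧ x k ≡ true))
  reduce r n x k e with n ≤? starBound r
  ... | yes n≤M = n , n≤M , e
  reduce r zero          x k e | no n≰M = ⊥-elim (n≰M z≤n)
  reduce r (suc zero)    x k e | no n≰M = ⊥-elim (n≰M (s≤s z≤n))
  reduce r (suc (suc m)) x k e | no n≰M =
    reduce r (suc m) x k (shorten r m x k (≤-trans (≤-pred (≤-pred (≰⇒> n≰M))) (m≤m+n m x)) e)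

  star : Rel → Rel
  star r = powersUpTo r (starBound r)

  star-intro : ∀ r n x k → ⟦ power r n ⟧ x k ≡ true → ⟦ star r ⟧ x k ≡ true
  star-intro r n x k e with reduce r n x k e
  ... | n′ , n′≤M , p = powersUpTo-intro r (starBound r) n′ x k n′≤M p

  star-elim : ∀ r x k → ⟦ star r ⟧ x k ≡ true → Σ ℕ (λ n → ⟦ power r n ⟧ x k ≡ true)
  star-elim r x k e with powersUpTo-elim r (starBound r) x k e
  ... | n , _ , p = n , p

  star-unfoldˡ : ∀ r → oneR ⊕ r ⊗ star r ⊑ star r
  star-unfoldˡ r = ⊆⇒⊑ unfold
    where
      unfold : oneR ⊕ r ⊗ star r ⊆ star r
      unfold x k e with ⊕-elim oneR (r ⊗ star r) x k e
      ... | inj₁ d₁ = star-intro r 0 x k d₁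
      ... | inj₂ rs with ⊗-elim r (star r) x k rs
      ...   | i , j , s , d , st with star-elim r (x + i) j st
      ...     | n , p = star-intro r (suc n) x k (⊗-intro r (power r n) x k (i , j , s , d , p))

  star-unfoldʳ : ∀ r → oneR ⊕ star r ⊗ r ⊑ star r
  star-unfoldʳ r = ⊆⇒⊑ unfold
    where
      unfold : oneR ⊕ star r ⊗ r ⊆ star r
      unfold x k e with ⊕-elim oneR (star r ⊗ r) x k e
      ... | inj₁ d₁ = star-intro r 0 x k d₁
      ... | inj₂ sr with ⊗-elim (star r) r x k sr
      ...   | i , j , s , st , d with star-elim r x i st
      ...     | n , p = star-intro r (suc n) x k
                  (subst (λ z → ⟦ z ⟧ x k ≡ true) (sym (power-suc-right r n)) (⊗-intro (power r n) r x k (i , j , s , p , d)))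

  -- induction: if b ⊕ a ⊗ c ⊑ c then every aⁿ ⊗ b lies below c
  star-inductˡ : ∀ a b c → b ⊕ a ⊗ c ⊑ c → star a ⊗ b ⊑ c
  star-inductˡ a b c hyp = ⊆⇒⊑ below
    where
      closed : b ⊕ a ⊗ c ⊆ c
      closed = ⊑⇒⊆ hyp
      powers : ∀ n → power a n ⊗ b ⊆ c
      powers zero    x k e = closed x k (⊕-introˡ b (a ⊗ c) x k (subst (λ z → ⟦ z ⟧ x k ≡ true) (⊗-identityˡ b) e))
      powers (suc n) x k e with ⊗-elim a (power a n ⊗ b) x k (subst (λ z → ⟦ z ⟧ x k ≡ true) (⊗-assoc a (power a n) b) e)
      ... | i , j , s , da , rest =
        closed x k (⊕-introʳ b (a ⊗ c) x k (⊗-intro a c x k (i , j , s , da , powers n (x + i) j rest)))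
      below : star a ⊗ b ⊆ c
      below x k e with ⊗-elim (star a) b x k e
      ... | i , j , s , st , db with star-elim a x i st
      ...   | n , p = powers n x k (⊗-intro (power a n) b x k (i , j , s , p , db))

  star-inductʳ : ∀ a b c → b ⊕ c ⊗ a ⊑ c → b ⊗ star a ⊑ c
  star-inductʳ a b c hyp = ⊆⇒⊑ below
    where
      closed : b ⊕ c ⊗ a ⊆ c
      closed = ⊑⇒⊆ hyp
      powers : ∀ n → b ⊗ power a n ⊆ c
      powers zero    x k e = closed x k (⊕-introˡ b (c ⊗ a) x k (subst (λ z → ⟦ z ⟧ x k ≡ true) (⊗-identityʳ b) e))
      powers (suc n) x k e with ⊗-elim (b ⊗ power a n) a x k
                                  (subst (λ z → ⟦ z ⟧ x k ≡ true) (trans (cong (b ⊗_) (power-suc-right a n)) (sym (⊗-assoc b (power a n) a))) e)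
      ... | i , j , s , rest , da =
        closed x k (⊕-introʳ b (c ⊗ a) x k (⊗-intro c a x k (i , j , s , powers n x i rest , da)))
      below : b ⊗ star a ⊆ c
      below x k e with ⊗-elim b (star a) x k e
      ... | i , j , s , db , st with star-elim a (x + i) j st
      ...   | n , p = powers n x k (⊗-intro b (power a n) x k (i , j , s , db , p))

module Tests where

  open import Data.Nat using (ℕ; zero; suc; _≤_; _+_)
  open import Data.Nat.Properties using (+-identityʳ)
  open import Data.Bool using (Bool; true; false; _∧_; _∨_; not)
  import Data.Bool.Properties as Bool
  open import Data.Product using (Σ; _×_; _,_; proj₁; proj₂)
  open import Data.Empty using (⊥-elim)
  open import Relation.Binary.PropositionalEquality using (_≡_; refl; sym; trans; cong; cong₂; subst)
  open Booleans
  open FinCof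
  open Shapes
  open Relations
  open Operations
  open Laws

  -- pairs of a test lie on the diagonal, i.e. have offset 0
  isZero : ℕ → Bool
  isZero zero    = true
  isZero (suc _) = false

  abstract
    testR : FinCof → Rel
    testR P = fromRegular (λ x k → mem P x ∧ isZero k) (bound P) 1

    ⟦test⟧ : ∀ P x k → ⟦ testR P ⟧ x k ≡ mem P x ∧ isZero k
    ⟦test⟧ P = ⟦⟧-fromRegular (λ x k → mem P x ∧ isZero k) (bound P) 1 (rows , cols) upClosed
      where
        rows : ∀ x k → bound P ≤ x → mem P x ∧ isZero k ≡ mem P (bound P) ∧ isZero k
        rows x k le = cong (_∧ isZero k) (mem-beyond P x le)
        cols : ∀ x k → 1 ≤ k → mem P x ∧ isZero k ≡ mem P x ∧ isZero 1
        cols x (suc k) _ = refl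
        upClosed : UpClosed (λ k → mem P (bound P) ∧ isZero k)
        upClosed (suc k) _ e = ⊥-elim (false≢true (trans (sym (Bool.∧-zeroʳ (mem P (bound P)))) e))

  test-elim : ∀ P x k → ⟦ testR P ⟧ x k ≡ true → (mem P x ≡ true) × (k ≡ 0)
  test-elim P x zero    e = trans (sym (Bool.∧-identityʳ (mem P x))) (trans (sym (⟦test⟧ P x 0)) e) , refl
  test-elim P x (suc k) e = ⊥-elim (false≢true (trans (sym (Bool.∧-zeroʳ (mem P x))) (trans (sym (⟦test⟧ P x (suc k))) e)))

  test-intro : ∀ P x → mem P x ≡ true → ⟦ testR P ⟧ x 0 ≡ true
  test-intro P x e = trans (⟦test⟧ P x 0) (trans (Bool.∧-identityʳ (mem P x)) e)

  abstract
    complement : FinCof → FinCof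
    complement P = fromFun (λ x → not (mem P x)) (bound P)

    mem-complement : ∀ P x → mem (complement P) x ≡ not (mem P x)
    mem-complement P = mem-fromFun (λ x → not (mem P x)) (bound P) (λ k le → cong not (mem-beyond P k le))

  TestR : Set
  TestR = Σ Rel (λ p → (p ⊑ oneR) × Σ Rel (λ q → (p ⊕ q ≡ oneR) × (p ⊗ q ≡ zeroR) × (q ⊗ p ≡ zeroR)))

  ⌊_⌋T : TestR → Rel
  ⌊ t ⌋T = proj₁ t

  ¬T : TestR → Rel
  ¬T t = proj₁ (proj₂ (proj₂ t))

  disjoint-tests : ∀ P Q → (∀ x → mem Q x ≡ not (mem P x)) → testR P ⊗ testR Q ≡ zeroR
  disjoint-tests P Q Q≡¬P = ⊆-antisym meet (λ x k → zero-elim x k)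
    where
      meet : testR P ⊗ testR Q ⊆ zeroR
      meet x k e with ⊗-elim (testR P) (testR Q) x k e
      ... | i , j , _ , tp , tq with test-elim P x i tp | test-elim Q (x + i) j tq
      ...   | p , refl | q , _ = ⊥-elim (false≢true (trans (sym (not-true p))
                                 (trans (sym (Q≡¬P x)) (subst (λ z → mem Q z ≡ true) (+-identityʳ x) q))))

  setTest : FinCof → TestR
  setTest P = testR P , ⊆⇒⊑ below-one , testR (complement P) , covers ,
              disjoint-tests P (complement P) (mem-complement P) ,
              disjoint-tests (complement P) P (λ x → trans (sym (Bool.not-involutive (mem P x))) (cong not (sym (mem-complement P x))))
    where
      below-one : testR P ⊆ oneR
      below-one x k e with test-elim P x k e
      ... | _ , refl = one-intro x
      covers : testR P ⊕ testR (complement P) ≡ oneR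
      covers = Rel-ext _ _ λ x k → trans (⟦⊕⟧ (testR P) (testR (complement P)) x k)
        (trans (cong₂ _∨_ (⟦test⟧ P x k) (trans (⟦test⟧ (complement P) x k) (cong (_∧ isZero k) (mem-complement P x))))
        (trans (excluded-middle x (mem P x) k) (sym (⟦one⟧ x k))))
        where
          excluded-middle : ∀ y b k → (b ∧ isZero k) ∨ (not b ∧ isZero k) ≡ oneF y k
          excluded-middle y true  zero    = refl
          excluded-middle y false zero    = refl
          excluded-middle y true  (suc k) = refl
          excluded-middle y false (suc k) = refl

  swapT : TestR → TestR
  swapT (p , _ , q , p⊕q , pq , qp) = q , ⊆⇒⊑ q⊆1 , p , trans (⊕-comm q p) p⊕q , qp , pq
    where
      q⊆1 : q ⊆ oneR
      q⊆1 x k e = subst (λ z → ⟦ z ⟧ x k ≡ true) p⊕q (⊕-introʳ p q x k e)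

  module TestFacts (t : TestR) where
    private
      P Q : Rel
      P = ⌊ t ⌋T
      Q = ¬T t

    diagonal : ∀ x k → ⟦ P ⟧ x k ≡ true → k ≡ 0
    diagonal x k e = one-elim x k (⊑⇒⊆ (proj₁ (proj₂ t)) x k e)

    complement-at : ∀ x → ⟦ Q ⟧ x 0 ≡ not (⟦ P ⟧ x 0)
    complement-at x = exactly-one (⟦ P ⟧ x 0) (⟦ Q ⟧ x 0) one-of not-both
      where
        one-of : ⟦ P ⟧ x 0 ∨ ⟦ Q ⟧ x 0 ≡ true
        one-of = trans (sym (⟦⊕⟧ P Q x 0)) (subst (λ z → ⟦ z ⟧ x 0 ≡ true) (sym (proj₁ (proj₂ (proj₂ (proj₂ t))))) (one-intro x))
        not-both : ⟦ P ⟧ x 0 ≡ true → ⟦ Q ⟧ x 0 ≡ true → false ≡ true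
        not-both p q = trans (sym (⟦zero⟧ x 0)) (subst (λ z → ⟦ z ⟧ x 0 ≡ true) (proj₁ (proj₂ (proj₂ (proj₂ (proj₂ t)))))
                         (⊗-intro P Q x 0 (0 , 0 , refl , p , ⟦⟧-at Q (sym (+-identityʳ x)) refl q)))
        exactly-one : ∀ a b → a ∨ b ≡ true → (a ≡ true → b ≡ true → false ≡ true) → b ≡ not a
        exactly-one true  true  _ f = ⊥-elim (false≢true (f refl refl))
        exactly-one true  false _ _ = refl
        exactly-one false true  _ _ = refl

    complement-holds : ∀ x → ⟦ P ⟧ x 0 ≡ false → ⟦ Q ⟧ x 0 ≡ true
    complement-holds x e = trans (complement-at x) (cong not e)

    not-both : ∀ x → ⟦ P ⟧ x 0 ≡ true → ⟦ Q ⟧ x 0 ≡ true → false ≡ true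
    not-both x p q = trans (sym (cong not p)) (trans (sym (complement-at x)) q)

    restrictʳ-elim : ∀ r x k → ⟦ r ⊗ P ⟧ x k ≡ true → (⟦ r ⟧ x k ≡ true) × (⟦ P ⟧ (x + k) 0 ≡ true)
    restrictʳ-elim r x k e with ⊗-elim r P x k e
    ... | i , j , s , dr , dp with diagonal (x + i) j dp
    ...   | refl = subst (λ z → ⟦ r ⟧ x z ≡ true) i≡k dr , subst (λ z → ⟦ P ⟧ (x + z) 0 ≡ true) i≡k dp
      where
        i≡k : i ≡ k
        i≡k = trans (sym (+-identityʳ i)) s

    restrictʳ-intro : ∀ r x k → ⟦ r ⟧ x k ≡ true → ⟦ P ⟧ (x + k) 0 ≡ true → ⟦ r ⊗ P ⟧ x k ≡ true
    restrictʳ-intro r x k dr dp = ⊗-intro r P x k (k , 0 , +-identityʳ k , dr , dp)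

    restrictˡ-elim : ∀ r x k → ⟦ P ⊗ r ⟧ x k ≡ true → (⟦ P ⟧ x 0 ≡ true) × (⟦ r ⟧ x k ≡ true)
    restrictˡ-elim r x k e with ⊗-elim P r x k e
    ... | i , j , s , dp , dr with diagonal x i dp
    ...   | refl = dp , ⟦⟧-at r (+-identityʳ x) s dr

    restrictˡ-intro : ∀ r x k → ⟦ P ⟧ x 0 ≡ true → ⟦ r ⟧ x k ≡ true → ⟦ P ⊗ r ⟧ x k ≡ true
    restrictˡ-intro r x k dp dr = ⊗-intro P r x k (0 , k , refl , dp , ⟦⟧-at r (sym (+-identityʳ x)) refl dr)

  ⊑zero-elim : ∀ {r} → r ⊑ zeroR → ∀ x k → ⟦ r ⟧ x k ≡ true → false ≡ true
  ⊑zero-elim r⊑0 x k e = trans (sym (⟦zero⟧ x k)) (⊑⇒⊆ r⊑0 x k e)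

  ⊑zero-intro : ∀ {r} → (∀ x k → ⟦ r ⟧ x k ≡ true → false ≡ true) → r ⊑ zeroR
  ⊑zero-intro none = ⊆⇒⊑ (λ x k e → ⊥-elim (false≢true (none x k e)))

module Modalities where

  open import Data.Nat using (ℕ; suc; _≤_; s≤s; _+_; _∸_)
  open import Data.Nat.Properties
  open import Data.Bool using (Bool; true; false)
  open import Data.Product using (Σ; _×_; _,_; proj₁; proj₂)
  open import Data.Empty using (⊥-elim)
  open import Relation.Nullary using (yes; no)
  open import Relation.Binary.PropositionalEquality using (_≡_; refl; sym; trans; cong; subst)
  open Booleans
  open FinCof
  open Relations
  open Composition
  open Operations
  open Laws
  open Tests

  -- The domain of a relation: by regularity it suffices to look at offsets ≤ K.
  domainF : Rel → ℕ → Bool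
  domainF r x = anyUpTo (offsetBound r) (⟦ r ⟧ x)

  abstract
    domain : Rel → FinCof
    domain r = fromFun (domainF r) (rowBound r)

    mem-domain : ∀ r x → mem (domain r) x ≡ domainF r x
    mem-domain r = mem-fromFun (domainF r) (rowBound r)
      (λ y le → anyUpTo-cong (offsetBound r) _ _ (λ k → proj₁ (regular r) y k le))

  domain-intro : ∀ r x k → ⟦ r ⟧ x k ≡ true → mem (domain r) x ≡ true
  domain-intro r x k e with k ≤? offsetBound r
  ... | yes k≤K = trans (mem-domain r x) (anyUpTo-intro (offsetBound r) (⟦ r ⟧ x) k k≤K e)
  ... | no  k≰K = trans (mem-domain r x) (anyUpTo-intro (offsetBound r) (⟦ r ⟧ x) (offsetBound r) ≤-refl
                    (trans (sym (proj₂ (regular r) x k (<⇒≤ (≰⇒> k≰K)))) e))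

  domain-elim : ∀ r x → mem (domain r) x ≡ true → Σ ℕ (λ k → ⟦ r ⟧ x k ≡ true)
  domain-elim r x e with anyUpTo-elim (offsetBound r) (⟦ r ⟧ x) (trans (sym (mem-domain r x)) e)
  ... | k , _ , d = k , d

  codomainF : Rel → ℕ → Bool
  codomainF r y = anyUpTo y (λ x → ⟦ r ⟧ x (y ∸ x))

  Reaches : Rel → ℕ → Set
  Reaches r y = Σ ℕ (λ x → Σ ℕ (λ k → (x + k ≡ y) × (⟦ r ⟧ x k ≡ true)))

  codomainF-elim : ∀ r y → codomainF r y ≡ true → Reaches r y
  codomainF-elim r y e with anyUpTo-elim y (λ x → ⟦ r ⟧ x (y ∸ x)) e
  ... | x , x≤y , d = x , y ∸ x , m+[n∸m]≡n x≤y , d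

  codomainF-intro : ∀ r y → Reaches r y → codomainF r y ≡ true
  codomainF-intro r y (x , k , refl , d) =
    anyUpTo-intro (x + k) (λ z → ⟦ r ⟧ z (x + k ∸ z)) x (m≤m+n x k) (subst (λ z → ⟦ r ⟧ x z ≡ true) (sym (m+n∸m≡n x k)) d)

  -- Beyond N + K the codomain is constant: a pair (x , x + k) reaching y can be
  -- moved to reach y + 1 by lengthening k (if k ≥ K) or shifting x (if x ≥ N), and back.
  module CodomainConstant (r : Rel) where
    private
      N K : ℕ
      N = rowBound r
      K = offsetBound r
      rows : ∀ x k → N ≤ x → ⟦ r ⟧ x k ≡ ⟦ r ⟧ N k
      rows = proj₁ (regular r)
      cols : ∀ x k → K ≤ k → ⟦ r ⟧ x k ≡ ⟦ r ⟧ x K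
      cols = proj₂ (regular r)

    codomain-grow : ∀ y → N + K ≤ y → codomainF r y ≡ true → codomainF r (suc y) ≡ true
    codomain-grow y big e with codomainF-elim r y e
    ... | x , k , s , d with K ≤? k
    ...   | yes K≤k = codomainF-intro r (suc y) (x , suc k , trans (+-suc x k) (cong suc s) ,
                        trans (cols x (suc k) (≤-trans K≤k (n≤1+n k))) (trans (sym (cols x k K≤k)) d))
    ...   | no  K≰k = codomainF-intro r (suc y) (suc x , k , cong suc s ,
                        trans (rows (suc x) k (≤-trans N≤x (n≤1+n x))) (trans (sym (rows x k N≤x)) d))
      where
        N≤x : N ≤ x
        N≤x = split-long s big (<⇒≤ (≰⇒> K≰k))

    codomain-shrink : ∀ y → N + K ≤ y → codomainF r (suc y) ≡ true → codomainF r y ≡ true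
    codomain-shrink y big e with codomainF-elim r (suc y) e
    ... | x , k , s , d with K <? k
    codomain-shrink y big e | x , suc k , s , d | yes (s≤s K≤k) =
      codomainF-intro r y (x , k , suc-injective (trans (sym (+-suc x k)) s) ,
        trans (cols x k K≤k) (trans (sym (cols x (suc k) (≤-trans K≤k (n≤1+n k)))) d))
    codomain-shrink y big e | x , k , s , d | no K≮k = shift-back x (split-long {m = suc N} s (s≤s big) (≮⇒≥ K≮k)) s d
      where
        shift-back : ∀ x → suc N ≤ x → x + k ≡ suc y → ⟦ r ⟧ x k ≡ true → codomainF r y ≡ true
        shift-back (suc x′) (s≤s N≤x′) s d = codomainF-intro r y (x′ , k , suc-injective s ,
          trans (rows x′ k N≤x′) (trans (sym (rows (suc x′) k (≤-trans N≤x′ (n≤1+n x′)))) d))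

    codomain-constant : ∀ y → N + K ≤ y → codomainF r y ≡ codomainF r (N + K)
    codomain-constant = constant-from (codomainF r) (N + K) (λ y big → true-ext (codomain-grow y big) (codomain-shrink y big))

  abstract
    codomain : Rel → FinCof
    codomain r = fromFun (codomainF r) (rowBound r + offsetBound r)

    mem-codomain : ∀ r y → mem (codomain r) y ≡ codomainF r y
    mem-codomain r = mem-fromFun (codomainF r) (rowBound r + offsetBound r) (CodomainConstant.codomain-constant r)

  codomain-intro : ∀ r x k → ⟦ r ⟧ x k ≡ true → mem (codomain r) (x + k) ≡ true
  codomain-intro r x k d = trans (mem-codomain r (x + k)) (codomainF-intro r (x + k) (x , k , refl , d))

  codomain-elim : ∀ r y → mem (codomain r) y ≡ true → Reaches r y
  codomain-elim r y e = codomainF-elim r y (trans (sym (mem-codomain r y)) e)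

  fdiaR : Rel → TestR → TestR
  fdiaR a p = setTest (domain (a ⊗ ⌊ p ⌋T))

  bdiaR : Rel → TestR → TestR
  bdiaR a p = setTest (codomain (⌊ p ⌋T ⊗ a))

  fdia-galoisʳ : ∀ a (p q : TestR) → ⌊ fdiaR a p ⌋T ⊑ ⌊ q ⌋T → ¬T q ⊗ a ⊗ ⌊ p ⌋T ⊑ zeroR
  fdia-galoisʳ a p q |a⟩p⊑q = ⊑zero-intro λ x k e →
    let (nqa , pk) = TestFacts.restrictʳ-elim p (¬T q ⊗ a) x k e
        (nq , ak)  = TestFacts.restrictˡ-elim (swapT q) a x k nqa
        in-domain  = domain-intro (a ⊗ ⌊ p ⌋T) x k (TestFacts.restrictʳ-intro p a x k ak pk)
    in TestFacts.not-both q x (⊑⇒⊆ |a⟩p⊑q x 0 (test-intro _ x in-domain)) nq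

  fdia-galoisˡ : ∀ a (p q : TestR) → ¬T q ⊗ a ⊗ ⌊ p ⌋T ⊑ zeroR → ⌊ fdiaR a p ⌋T ⊑ ⌊ q ⌋T
  fdia-galoisˡ a p q empty = ⊆⇒⊑ λ x k e → in-q x k (test-elim _ x k e)
    where
      in-q : ∀ x k → (mem (domain (a ⊗ ⌊ p ⌋T)) x ≡ true) × (k ≡ 0) → ⟦ ⌊ q ⌋T ⟧ x k ≡ true
      in-q x .0 (in-domain , refl) with ⟦ ⌊ q ⌋T ⟧ x 0 in qx
      ... | true  = refl
      ... | false with domain-elim (a ⊗ ⌊ p ⌋T) x in-domain
      ...   | k′ , d with TestFacts.restrictʳ-elim p a x k′ d
      ...     | ak , pk = ⊥-elim (false≢true (⊑zero-elim empty x k′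
                (TestFacts.restrictʳ-intro p (¬T q ⊗ a) x k′ (TestFacts.restrictˡ-intro (swapT q) a x k′ (TestFacts.complement-holds q x qx) ak) pk)))

  bdia-galoisʳ : ∀ a (p q : TestR) → ⌊ bdiaR a p ⌋T ⊑ ⌊ q ⌋T → ⌊ p ⌋T ⊗ a ⊗ ¬T q ⊑ zeroR
  bdia-galoisʳ a p q ⟨a|p⊑q = ⊑zero-intro λ x k e →
    let (pa , nq) = TestFacts.restrictʳ-elim (swapT q) (⌊ p ⌋T ⊗ a) x k e
        in-codomain = codomain-intro (⌊ p ⌋T ⊗ a) x k pa
    in TestFacts.not-both q (x + k) (⊑⇒⊆ ⟨a|p⊑q (x + k) 0 (test-intro _ (x + k) in-codomain)) nq

  bdia-galoisˡ : ∀ a (p q : TestR) → ⌊ p ⌋T ⊗ a ⊗ ¬T q ⊑ zeroR → ⌊ bdiaR a p ⌋T ⊑ ⌊ q ⌋T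
  bdia-galoisˡ a p q empty = ⊆⇒⊑ λ y k e → in-q y k (test-elim _ y k e)
    where
      in-q : ∀ y k → (mem (codomain (⌊ p ⌋T ⊗ a)) y ≡ true) × (k ≡ 0) → ⟦ ⌊ q ⌋T ⟧ y k ≡ true
      in-q y .0 (in-codomain , refl) with ⟦ ⌊ q ⌋T ⟧ y 0 in qy
      ... | true  = refl
      ... | false with codomain-elim (⌊ p ⌋T ⊗ a) y in-codomain
      ...   | x , k′ , refl , d = ⊥-elim (false≢true (⊑zero-elim empty x k′
                (TestFacts.restrictʳ-intro (swapT q) (⌊ p ⌋T ⊗ a) x k′ d (TestFacts.complement-holds q (x + k′) qy))))

  -- |a ⊗ b⟩p = |a⟩|b⟩p: a point has an (a ⊗ b)-path into p iff it has an a-step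
  -- into the domain of b ⊗ p.
  fdia-comp : ∀ a b (p : TestR) → ⌊ fdiaR (a ⊗ b) p ⌋T ≡ ⌊ fdiaR a (fdiaR b p) ⌋T
  fdia-comp a b p = cong testR (FinCof-ext (domain (a ⊗ b ⊗ P)) (domain (a ⊗ T)) λ x → true-ext (to x) (from x))
    where
      P : Rel
      P = ⌊ p ⌋T
      T : Rel
      T = testR (domain (b ⊗ P))
      to : ∀ x → mem (domain (a ⊗ b ⊗ P)) x ≡ true → mem (domain (a ⊗ T)) x ≡ true
      to x e with domain-elim (a ⊗ b ⊗ P) x e
      ... | k , d with ⊗-elim a (b ⊗ P) x k (subst (λ z → ⟦ z ⟧ x k ≡ true) (⊗-assoc a b P) d)
      ...   | i , j , s , da , bp = domain-intro (a ⊗ T) x i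
              (⊗-intro a T x i (i , 0 , +-identityʳ i , da , test-intro _ (x + i) (domain-intro (b ⊗ P) (x + i) j bp)))
      from : ∀ x → mem (domain (a ⊗ T)) x ≡ true → mem (domain (a ⊗ b ⊗ P)) x ≡ true
      from x e with domain-elim (a ⊗ T) x e
      ... | k , d with ⊗-elim a T x k d
      ...   | i , j , s , da , dt with test-elim _ (x + i) j dt
      ...     | in-domain , refl with domain-elim (b ⊗ P) (x + i) in-domain
      ...       | k′ , bp = domain-intro (a ⊗ b ⊗ P) x (i + k′)
                  (subst (λ z → ⟦ z ⟧ x (i + k′) ≡ true) (sym (⊗-assoc a b P)) (⊗-intro a (b ⊗ P) x (i + k′) (i , k′ , refl , da , bp)))

  bdia-comp : ∀ a b (p : TestR) → ⌊ bdiaR (a ⊗ b) p ⌋T ≡ ⌊ bdiaR b (bdiaR a p) ⌋T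
  bdia-comp a b p = cong testR (FinCof-ext (codomain (P ⊗ (a ⊗ b))) (codomain (T ⊗ b)) λ y → true-ext (to y) (from y))
    where
      P : Rel
      P = ⌊ p ⌋T
      T : Rel
      T = testR (codomain (P ⊗ a))
      to : ∀ y → mem (codomain (P ⊗ (a ⊗ b))) y ≡ true → mem (codomain (T ⊗ b)) y ≡ true
      to y e with codomain-elim (P ⊗ (a ⊗ b)) y e
      ... | x , k , refl , d with ⊗-elim (P ⊗ a) b x k (subst (λ z → ⟦ z ⟧ x k ≡ true) (sym (⊗-assoc P a b)) d)
      ...   | i , j , refl , pa , db = subst (λ z → mem (codomain (T ⊗ b)) z ≡ true) (+-assoc x i j)
              (codomain-intro (T ⊗ b) (x + i) j (⊗-intro T b (x + i) j (0 , j , refl ,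
                 test-intro _ (x + i) (codomain-intro (P ⊗ a) x i pa) , ⟦⟧-at b (sym (+-identityʳ _)) refl db)))
      from : ∀ y → mem (codomain (T ⊗ b)) y ≡ true → mem (codomain (P ⊗ (a ⊗ b))) y ≡ true
      from y e with codomain-elim (T ⊗ b) y e
      ... | x , k , refl , d with ⊗-elim T b x k d
      ...   | i , j , s , dt , db with test-elim _ x i dt
      ...     | in-codomain , refl with codomain-elim (P ⊗ a) x in-codomain
      ...       | x′ , k′ , refl , pa = subst (λ z → mem (codomain (P ⊗ (a ⊗ b))) z ≡ true) lengths
                  (codomain-intro (P ⊗ (a ⊗ b)) x′ (k′ + j) (subst (λ z → ⟦ z ⟧ x′ (k′ + j) ≡ true) (⊗-assoc P a b)
                    (⊗-intro (P ⊗ a) b x′ (k′ + j) (k′ , j , refl , pa , ⟦⟧-at b (+-identityʳ _) refl db))))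
        where
          lengths : x′ + (k′ + j) ≡ x′ + k′ + k
          lengths = trans (sym (+-assoc x′ k′ j)) (cong (x′ + k′ +_) s)

module Omega where

  open import Data.Nat using (zero; suc; _≤_; s≤s; _+_)
  open import Data.Nat.Properties
  open import Data.Bool using (true; false)
  open import Data.Product using (_,_; proj₁)
  open import Data.Sum using (inj₁; inj₂)
  open import Relation.Binary.PropositionalEquality using (_≡_; refl; sym; trans; cong; subst)
  open FinCof
  open Relations
  open Operations
  open Laws
  open Star
  open Tests

  loops : Rel → FinCof
  loops r = fromFun (λ x → ⟦ r ⟧ x 0) (rowBound r)

  mem-loops : ∀ r x → mem (loops r) x ≡ ⟦ r ⟧ x 0
  mem-loops r = mem-fromFun (λ x → ⟦ r ⟧ x 0) (rowBound r) (λ y le → proj₁ (regular r) y 0 le)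

  fromLoop : Rel → Rel
  fromLoop r = testR (loops r) ⊗ topR

  fromLoop-elim : ∀ r x k → ⟦ fromLoop r ⟧ x k ≡ true → ⟦ r ⟧ x 0 ≡ true
  fromLoop-elim r x k e with ⊗-elim (testR (loops r)) topR x k e
  ... | i , _ , _ , dt , _ = trans (sym (mem-loops r x)) (proj₁ (test-elim _ x i dt))

  fromLoop-intro : ∀ r x k → ⟦ r ⟧ x 0 ≡ true → ⟦ fromLoop r ⟧ x k ≡ true
  fromLoop-intro r x k loop = ⊗-intro (testR (loops r)) topR x k
    (0 , k , refl , test-intro _ x (trans (mem-loops r x) loop) , ⟦top⟧ _ _)

  -- In the model the only infinite r-paths are those that reach a loop (a path
  -- can take only finitely many positive steps below any target), so
  -- rω relates x to y when x reaches a loop point by r* and y is beyond x.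
  omega : Rel → Rel
  omega r = star r ⊗ fromLoop r

  omega-at-loop : ∀ r x k → ⟦ r ⟧ x 0 ≡ true → ⟦ omega r ⟧ x k ≡ true
  omega-at-loop r x k loop = ⊗-intro (star r) (fromLoop r) x k
    (0 , k , refl , star-intro r 0 x 0 (one-intro x) , fromLoop-intro r (x + 0) k (⟦⟧-at r (sym (+-identityʳ x)) refl loop))

  star-prepend : ∀ r s x i j → ⟦ r ⟧ x i ≡ true → ⟦ star r ⊗ s ⟧ (x + i) j ≡ true → ⟦ star r ⊗ s ⟧ x (i + j) ≡ true
  star-prepend r s x i j dr e with ⊗-elim (star r) s (x + i) j e
  ... | i′ , j′ , s′ , st , ds = ⊗-intro (star r) s x (i + j) (i + i′ , j′ , lengths , longer , ⟦⟧-at s (+-assoc x i i′) refl ds)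
    where
      lengths : i + i′ + j′ ≡ i + j
      lengths = trans (+-assoc i i′ j′) (cong (i +_) s′)
      longer : ⟦ star r ⟧ x (i + i′) ≡ true
      longer = ⊑⇒⊆ (star-unfoldˡ r) x (i + i′)
                 (⊕-introʳ oneR (r ⊗ star r) x (i + i′) (⊗-intro r (star r) x (i + i′) (i , i′ , refl , dr , st)))

  -- unfolding: split off the first step of the r*-path, or the loop itself
  omega-unfold : ∀ r → omega r ⊑ r ⊗ omega r
  omega-unfold r = ⊆⇒⊑ unfold
    where
      unfold : omega r ⊆ r ⊗ omega r
      unfold x k e with ⊗-elim (star r) (fromLoop r) x k e
      ... | i , j , s , st , fl with star-elim r x i st
      ...   | zero , p with one-elim x i p
      ...     | refl = ⊗-intro r (omega r) x k (0 , k , refl , loop , omega-at-loop r (x + 0) k (⟦⟧-at r (sym (+-identityʳ x)) refl loop))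
        where
          loop : ⟦ r ⟧ x 0 ≡ true
          loop = ⟦⟧-at r (+-identityʳ x) refl (fromLoop-elim r (x + 0) j fl)
      unfold x k e | i , j , s , st , fl | suc n , p with ⊗-elim r (power r n) x i p
      ...   | i₁ , i₂ , s₁ , dr , pn =
        ⊗-intro r (omega r) x k (i₁ , i₂ + j , lengths , dr ,
          ⊗-intro (star r) (fromLoop r) (x + i₁) (i₂ + j) (i₂ , j , refl , star-intro r n (x + i₁) i₂ pn ,
            ⟦⟧-at (fromLoop r) (trans (cong (x +_) (sym s₁)) (sym (+-assoc x i₁ i₂))) refl fl))
        where
          lengths : i₁ + (i₂ + j) ≡ k
          lengths = trans (sym (+-assoc i₁ i₂ j)) (trans (cong (_+ j) s₁) s)

  -- Coinduction, by induction on the offset: each pair of c either comes from b,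
  -- or starts with a loop of a, or with a positive a-step to a shorter pair of c.
  omega-coinduct : ∀ a b c → c ⊑ a ⊗ c ⊕ b → c ⊑ omega a ⊕ star a ⊗ b
  omega-coinduct a b c hyp = ⊆⇒⊑ (λ x k → below k k ≤-refl x)
    where
      target : Rel
      target = omega a ⊕ star a ⊗ b
      below : ∀ fuel k → k ≤ fuel → ∀ x → ⟦ c ⟧ x k ≡ true → ⟦ target ⟧ x k ≡ true
      below fuel k k≤fuel x e with ⊕-elim (a ⊗ c) b x k (⊑⇒⊆ hyp x k e)
      ... | inj₂ db = ⊕-introʳ (omega a) (star a ⊗ b) x k (⊗-intro (star a) b x k
            (0 , k , refl , star-intro a 0 x 0 (one-intro x) , ⟦⟧-at b (sym (+-identityʳ x)) refl db))
      ... | inj₁ ac with ⊗-elim a c x k ac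
      ...   | zero , j , s , loop , _ = ⊕-introˡ (omega a) (star a ⊗ b) x k (omega-at-loop a x k loop)
      below zero       k k≤0 x e | inj₁ ac | suc i , j , s , da , dc with trans s (n≤0⇒n≡0 k≤0)
      ... | ()
      below (suc fuel) k k≤fuel x e | inj₁ ac | suc i , j , s , da , dc
        with ⊕-elim (omega a) (star a ⊗ b) (x + suc i) j (below fuel j j≤fuel (x + suc i) dc)
        where
          j≤fuel : j ≤ fuel
          j≤fuel = ≤-pred (≤-trans (s≤s (m≤n+m j i)) (subst (_≤ suc fuel) (sym s) k≤fuel))
      ... | inj₁ w = ⊕-introˡ (omega a) (star a ⊗ b) x k (subst (λ z → ⟦ omega a ⟧ x z ≡ true) s (star-prepend a (fromLoop a) x (suc i) j da w))
      ... | inj₂ w = ⊕-introʳ (omega a) (star a ⊗ b) x k (subst (λ z → ⟦ star a ⊗ b ⟧ x z ≡ true) s (star-prepend a b x (suc i) j da w))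

  loop-free-omega : ∀ a → (∀ x → ⟦ a ⟧ x 0 ≡ false) → omega a ⊑ zeroR
  loop-free-omega a loop-free = ⊑zero-intro no-pair
    where
      no-pair : ∀ x k → ⟦ omega a ⟧ x k ≡ true → false ≡ true
      no-pair x k e with ⊗-elim (star a) (fromLoop a) x k e
      ... | i , j , _ , _ , fl = trans (sym (loop-free (x + i))) (fromLoop-elim a (x + i) j fl)

module Model where

  open import Data.Nat using (ℕ; suc; _+_; _≡ᵇ_)
  open import Data.Nat.Properties using (+-identityʳ; +-cancelˡ-≡; <-irrefl; ≤-refl)
  open import Data.Bool using (true; false)
  open import Data.Product using (_,_; proj₁)
  open import Relation.Binary.PropositionalEquality using (_≡_; refl; sym; trans; subst)
  open Booleans
  open FinCof
  open Relations
  open Operations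
  open Laws
  open Star
  open Tests
  open Modalities
  open Omega

  model : ModalOmegaAlgebra 0ℓ
  model = record
    { Carrier = Rel ; _+_ = _⊕_ ; _·_ = _⊗_ ; 𝟘 = zeroR ; 𝟙 = oneR ; _⋆ = star ; _ω = omega
    ; +-assoc = ⊕-assoc ; +-comm = ⊕-comm ; +-identityˡ = ⊕-identityˡ ; +-idem = ⊕-idem
    ; ·-assoc = ⊗-assoc ; ·-identityˡ = ⊗-identityˡ ; ·-identityʳ = ⊗-identityʳ
    ; distribˡ = distribˡ ; distribʳ = distribʳ ; zeroˡ = ⊗-zeroˡ ; zeroʳ = ⊗-zeroʳ
    ; star-unfoldˡ = star-unfoldˡ ; star-inductˡ = star-inductˡ
    ; star-unfoldʳ = star-unfoldʳ ; star-inductʳ = star-inductʳ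
    ; omega-unfold = omega-unfold ; omega-coinduct = omega-coinduct
    ; fdia = fdiaR ; bdia = bdiaR
    ; fdia-galois = λ a p q → fdia-galoisʳ a p q , fdia-galoisˡ a p q
    ; bdia-galois = λ a p q → bdia-galoisʳ a p q , bdia-galoisˡ a p q
    ; fdia-comp = fdia-comp ; bdia-comp = bdia-comp
    }

  open ModalFacts model using (Total)

  singleton : ℕ → FinCof
  singleton y = fromFun (λ z → z ≡ᵇ y) (suc y)

  mem-singleton : ∀ y z → mem (singleton y) z ≡ (z ≡ᵇ y)
  mem-singleton y = mem-fromFun (λ z → z ≡ᵇ y) (suc y)
    (λ k y<k → trans (≡ᵇ-false k y (λ k≡y → <-irrefl (sym k≡y) y<k)) (sym (≡ᵇ-false (suc y) y (λ e → <-irrefl (sym e) ≤-refl))))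

  -- The model is extensional: if (x , x + k) ∈ a, then x ∈ |a⟩{x + k} ⊆ |b⟩{x + k},
  -- so b relates x to x + k as well.
  extensional : ModalOmegaAlgebra.Extensional model
  extensional a b |a⟩⊑|b⟩ = ⊆⇒⊑ in-b
    where
      in-b : a ⊆ b
      in-b x k e with domain-elim (b ⊗ S) x in-domain-b
        where
          S : Rel
          S = testR (singleton (x + k))
          in-domain-a : mem (domain (a ⊗ S)) x ≡ true
          in-domain-a = domain-intro (a ⊗ S) x k (⊗-intro a S x k (k , 0 , +-identityʳ k , e ,
                          test-intro _ (x + k) (trans (mem-singleton (x + k) (x + k)) (≡ᵇ-refl (x + k)))))
          in-domain-b : mem (domain (b ⊗ S)) x ≡ true
          in-domain-b = proj₁ (test-elim _ x 0 (⊑⇒⊆ (|a⟩⊑|b⟩ (setTest (singleton (x + k)))) x 0 (test-intro _ x in-domain-a)))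
      ... | k′ , d with ⊗-elim b (testR (singleton (x + k))) x k′ d
      ...   | i , j , s , db , ds = subst (λ z → ⟦ b ⟧ x z ≡ true) i≡k db
        where
          i≡k : i ≡ k
          i≡k = +-cancelˡ-≡ x i k (≡ᵇ-sound (x + i) (x + k)
                  (trans (sym (mem-singleton (x + k) (x + i))) (proj₁ (test-elim _ (x + i) j ds))))

  model-nontrivial : ¬ (oneR ⊑ zeroR)
  model-nontrivial 1⊑0 = false≢true (⊑zero-elim 1⊑0 0 0 (one-intro 0))

  lt-ωNoetherian : ModalOmegaAlgebra.ωNoetherian model ltR
  lt-ωNoetherian = loop-free-omega ltR ⟦lt⟧-zero

  -- every point x has the lt-successor x + 1
  lt-total : Total ltR
  lt-total r r·lt⊑0 = ⊑zero-intro no-pair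
    where
      no-pair : ∀ x k → ⟦ ⌊ r ⌋T ⟧ x k ≡ true → false ≡ true
      no-pair x k e with TestFacts.diagonal r x k e
      ... | refl = ⊑zero-elim r·lt⊑0 x 1 (TestFacts.restrictˡ-intro r ltR x 1 e (⟦lt⟧-one x))

open ModalFacts
open Operations using (zeroR; ltR)
open Model

lemma6p4 : ((M : ModalOmegaAlgebra 0ℓ) → (a : ModalOmegaAlgebra.Carrier M) →
        ModalOmegaAlgebra.Noetherian M a → ModalOmegaAlgebra.ωNoetherian M a)
    × (Σ[ M ∈ ModalOmegaAlgebra 0ℓ ] Σ[ a ∈ ModalOmegaAlgebra.Carrier M ]
        (ModalOmegaAlgebra.ωNoetherian M a × ModalOmegaAlgebra.Noetherian M a))
    × (Σ[ M ∈ ModalOmegaAlgebra 0ℓ ] Σ[ a ∈ ModalOmegaAlgebra.Carrier M ]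
        (ModalOmegaAlgebra.ωNoetherian M a × ¬ ModalOmegaAlgebra.Noetherian M a))
    × (Σ[ M ∈ ModalOmegaAlgebra 0ℓ ] (ModalOmegaAlgebra.Extensional M
        × Σ[ a ∈ ModalOmegaAlgebra.Carrier M ]
            (ModalOmegaAlgebra.ωNoetherian M a × ¬ ModalOmegaAlgebra.Noetherian M a)))
lemma6p4 =
  (λ M → noetherian⇒ωNoetherian M) ,
  (model , zeroR , noetherian⇒ωNoetherian model zeroR (𝟘-noetherian model) , 𝟘-noetherian model) ,
  (model , ltR , lt-ωNoetherian , lt-not-noetherian) ,
  (model , extensional , ltR , lt-ωNoetherian , lt-not-noetherian)
  where
    lt-not-noetherian : ¬ ModalOmegaAlgebra.Noetherian model ltR
    lt-not-noetherian = total⇒¬noetherian model model-nontrivial ltR lt-total
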